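{- Let $v\in\mathfrak{S}_n$ be a $321$-avoiding and $2$-repeating permutation. Then $$\tilde{R}_{e,v}(t)=t^{n_v^1}\prod_{i=1}^{\kappa(v)}\mathcal{F}_{\lambda_i}(t).$$
   Context: $\mathfrak{S}_n$ has Coxeter generators $s_i=(i,i+1)$, $1\le i<n$. A permutation is $321$-avoiding if no reduced expression of it contains a subword of consecutive letters of the form $s_is_{i\pm1}s_i$; then the number $n_v(i)$ of occurrences of $s_i$ in a reduced expression of $v$ is independent of the expression, and $v$ is $2$-repeating if $n_v(i)\le2$ for all $i$. Let $n_v^1$ be the number of $i$ with $n_v(i)=1$. A $2$-chain of $v$ is a maximal set of consecutive integers $\{a,a+1,\dots,b\}$ with $n_v(i)=2$ for all $a\le i\le b$ (i.e. $n_v(a-1)\neq2$ and $n_v(b+1)\neq 2$). Let $\kappa(v)$ be the number of $2$-chains, $c_1,\dots,c_{\kappa(v)}$ the $2$-chains ordered increasingly, and $\lambda_i=|c_i|$. Fibonacci polynomials: $F_0=1$, $F_1(t)=t$, $F_m=tF_{m-1}+F_{m-2}$; modified Fibonacci polynomials $\mathcal{F}_m(t)=t^{m-1}F_{m+1}(t)$ for $m\ge1$. Hecke algebra: generated over $\mathbb{Z}[t,t^{ -1}]$ by $H_s$ with $H_s^2=1+(t^{ -1}-t)H_s$ and braid relations; $H_w=H_{s_{i_1}}\cdots H_{s_{i_k}}$ for a reduced expression; $R_{u,w}$ is defined by $(H_{w^{ -1}})^{ -1}=\sum_u R_{u,w}(t)H_u$, and $\tilde{R}_{u,w}\in\mathbb{N}[t]$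 is the unique polynomial with $R_{u,w}(t)=\tilde{R}_{u,w}(t-t^{ -1})$. -}

module Defs where

open import Data.Nat as ℕ using (ℕ; zero; suc; _<_; _≤_; _<ᵇ_)
open import Data.Integer as ℤ using (ℤ; +_; -[1+_])
open import Data.List using (List; []; _∷_; _++_; length; map; foldl; foldr; replicate; filter; upTo; concatMap)
open import Data.List.Relation.Unary.All using (All)
open import Data.List.Properties as LP using ()
open import Data.Product using (_×_; _,_; ∃-syntax)
open import Data.Sum using (_⊎_)
open import Data.Bool using (Bool; true; false; if_then_else_)
open import Relation.Nullary using (¬_; yes; no)
open import Relation.Nullary.Decidable using (⌊_⌋)
open import Relation.Binary.PropositionalEquality using (_≡_)

-- Polynomials in ℤ[t] : coefficient lists, ascending degree

Poly : Set
Poly = List ℤ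

addP : Poly → Poly → Poly
addP []       q        = q
addP p        []       = p
addP (a ∷ p)  (b ∷ q)  = (a ℤ.+ b) ∷ addP p q

mulP : Poly → Poly → Poly
mulP []      q = []
mulP (a ∷ p) q = addP (map (a ℤ.*_) q) (+ 0 ∷ mulP p q)

monoP : ℕ → Poly
monoP k = replicate k (+ 0) ++ (+ 1 ∷ [])

fibP : ℕ → Poly
fibP zero                = + 1 ∷ []
fibP (suc zero)          = + 0 ∷ + 1 ∷ []
fibP (suc (suc m))       = addP (mulP (monoP 1) (fibP (suc m))) (fibP m)

-- modified Fibonacci polynomials: 𝓕_m = t^{m-1} F_{m+1} for m ≥ 1
-- (the value at m = 0 is never used: 2-chains are nonempty)
modFibP : ℕ → Poly
modFibP zero    = + 1 ∷ []
modFibP (suc k) = mulP (monoP k) (fibP (suc (suc k)))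

-- Laurent polynomials in ℤ[t,t⁻¹]: (s , cs) represents t^{-s} · Σ cs_i t^i

Laurent : Set
Laurent = ℕ × Poly

lookupD : ℕ → Poly → ℤ
lookupD _       []       = + 0
lookupD zero    (a ∷ _)  = a
lookupD (suc m) (_ ∷ cs) = lookupD m cs

coeffL : Laurent → ℤ → ℤ
coeffL (s , cs) k with k ℤ.+ (+ s)
... | + m      = lookupD m cs
... | -[1+ _ ] = + 0

_≈L_ : Laurent → Laurent → Set
p ≈L q = ∀ (k : ℤ) → coeffL p k ≡ coeffL q k

constL : ℤ → Laurent
constL a = (0 , a ∷ [])

addL : Laurent → Laurent → Laurent
addL (s₁ , c₁) (s₂ , c₂) = (s₁ ℕ.+ s₂ , addP (mulP (monoP s₂) c₁) (mulP (monoP s₁) c₂))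

mulL : Laurent → Laurent → Laurent
mulL (s₁ , c₁) (s₂ , c₂) = (s₁ ℕ.+ s₂ , mulP c₁ c₂)

negL : Laurent → Laurent
negL (s , c) = (s , map ℤ.-_ c)

tL : Laurent
tL = (0 , monoP 1)

tinvL : Laurent
tinvL = (1 , monoP 0)

tMinusTinv : Laurent
tMinusTinv = addL tL (negL tinvL)

evalAt : Poly → Laurent → Laurent
evalAt []      x = constL (+ 0)
evalAt (a ∷ p) x = addL (constL a) (mulL x (evalAt p x))

-- Symmetric group 𝔖_n: permutations of {0,…,n-1} in one-line notation
-- (list [u(0),…,u(n-1)]).  Generator s_i (0 ≤ i, i+1 < n) is the
-- transposition (i,i+1); paper's s_{i+1} is our s_i (0-based).

Perm : Set
Perm = List ℕ

idP : ℕ → Perm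
idP n = upTo n

-- right multiplication u ↦ u s_i : swap the entries in positions i, i+1
rmul : Perm → ℕ → Perm
rmul []           _       = []
rmul (x ∷ [])     _       = x ∷ []
rmul (x ∷ y ∷ xs) zero    = y ∷ x ∷ xs
rmul (x ∷ xs)     (suc i) = x ∷ rmul xs i

prodW : ℕ → List ℕ → Perm
prodW n w = foldl rmul (idP n) w

-- Coxeter length of a permutation in 𝔖_n = number of inversions
countLess : ℕ → List ℕ → ℕ
countLess x []       = 0
countLess x (y ∷ ys) = (if y <ᵇ x then 1 else 0) ℕ.+ countLess x ys

len : Perm → ℕ
len []       = 0
len (x ∷ xs) = countLess x xs ℕ.+ len xs

ValidWord : ℕ → List ℕ → Set
ValidWord n w = All (λ i → suc i < n) w

ReducedExpr : ℕ → Perm → List ℕ → Set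
ReducedExpr n v w =
  ValidWord n w × prodW n w ≡ v ×
  (∀ (w' : List ℕ) → ValidWord n w' → prodW n w' ≡ v → length w ≤ length w')

HasBraid : List ℕ → Set
HasBraid w = ∃[ pre ] ∃[ suf ] ∃[ i ] ∃[ j ]
  (w ≡ pre ++ (i ∷ j ∷ i ∷ suf)) × (j ≡ suc i ⊎ i ≡ suc j)

Avoids321 : ℕ → Perm → Set
Avoids321 n v = ∀ (w : List ℕ) → ReducedExpr n v w → ¬ HasBraid w

count : ℕ → List ℕ → ℕ
count i []       = 0
count i (j ∷ w)  = (if ⌊ i ℕ.≟ j ⌋ then 1 else 0) ℕ.+ count i w

countSeq : ℕ → List ℕ → List ℕ
countSeq n w = map (λ i → count i w) (upTo (n ℕ.∸ 1))

nOne : ℕ → List ℕ → ℕ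
nOne n w = length (filter (λ c → c ℕ.≟ 1) (countSeq n w))

-- lengths of the 2-chains (maximal runs of consecutive i with n_v(i) = 2),
-- in increasing order; k is the length of the current run
flush : ℕ → List ℕ → List ℕ
flush zero    r = r
flush (suc k) r = suc k ∷ r

chainLens : ℕ → List ℕ → List ℕ
chainLens k []                  = flush k []
chainLens k (suc (suc zero) ∷ xs) = chainLens (suc k) xs
chainLens k (_ ∷ xs)            = flush k (chainLens 0 xs)

chains : ℕ → List ℕ → List ℕ
chains n w = chainLens 0 (countSeq n w)

rhsPoly : ℕ → List ℕ → Poly
rhsPoly n w = mulP (monoP (nOne n w)) (foldr (λ λi acc → mulP (modFibP λi) acc) (+ 1 ∷ []) (chains n w))

-- Hecke algebra: free ℤ[t,t⁻¹]-module with basis H_u (u ∈ 𝔖_n); elements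
-- are formal sums, represented as lists of (u , coefficient).

HeckeElt : Set
HeckeElt = List (Perm × Laurent)

coeffH : Perm → HeckeElt → Laurent
coeffH u []              = constL (+ 0)
coeffH u ((v , c) ∷ xs) with LP.≡-dec ℕ._≟_ u v
... | yes _ = addL c (coeffH u xs)
... | no  _ = coeffH u xs

-- right multiplication by H_{s_i}⁻¹ = H_{s_i} + (t - t⁻¹):
--   H_u H_s⁻¹ = H_{us} + (t - t⁻¹) H_u   if ℓ(us) > ℓ(u)
--   H_u H_s⁻¹ = H_{us}                   if ℓ(us) < ℓ(u)
rmulHinv : HeckeElt → ℕ → HeckeElt
rmulHinv h i = concatMap step h
  where
  step : Perm × Laurent → HeckeElt
  step (u , c) with len u <ᵇ len (rmul u i)
  ... | true  = (rmul u i , c) ∷ (u , mulL tMinusTinv c) ∷ []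
  ... | false = (rmul u i , c) ∷ []

-- (H_{v⁻¹})⁻¹ for v = s_{i₁}⋯s_{iₖ} (reduced):
--   H_{v⁻¹} = H_{s_{iₖ}}⋯H_{s_{i₁}}, so (H_{v⁻¹})⁻¹ = H_{s_{i₁}}⁻¹⋯H_{s_{iₖ}}⁻¹
heckeInvRev : ℕ → List ℕ → HeckeElt
heckeInvRev n w = foldl rmulHinv ((idP n , constL (+ 1)) ∷ []) w

Rev : ℕ → List ℕ → Laurent
Rev n w = coeffH (idP n) (heckeInvRev n w)

{-# OPTIONS --safe #-}
module Submission where

-- R_{e,v} is the coefficient of H_e in H_{s_{i₁}}⁻¹ ⋯ H_{s_{iₘ}}⁻¹ for a reduced word i₁ ⋯ iₘ of v, and
-- H_u H_s⁻¹ = H_{us} + [us > u] (t − t⁻¹) H_u. So R̃_{e,v} counts, with weight t^(number of stays), the paths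
-- that read the word letter by letter and either multiply by s_i or, at an ascent, stay, and that end at e.
-- For a reduced 321-avoiding word both neighbours of a letter occur between any two of its occurrences.
-- Consequently a path can only reach e if it skips every letter occurring once, multiplies by both or by
-- neither occurrence of a letter occurring twice, and the letters it multiplies by are pairwise non-adjacent;
-- every other path can no longer reach e. Hence R̃_{e,v} = t^{n¹} Σ_S t^{2 · #(doubled letters ∖ S)}
-- over the sets S of pairwise non-adjacent doubled letters, and this sum factors over the 2-chains, a chain
-- of length λ contributing 𝓕_λ, which satisfies 𝓕_λ = t² (𝓕_{λ-1} + 𝓕_{λ-2}).

open import Defs
open import Data.Nat as ℕ using (ℕ; zero; suc; _∸_; _<_; _≤_; z≤n; s≤s; _<ᵇ_)
import Data.Nat.Properties as ℕₚ
open import Algebra.Properties.CommutativeSemigroup ℕₚ.+-commutativeSemigroup using () renaming (x∙yz≈y∙xz to +-left-comm)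
open import Data.List using (List; []; _∷_; _++_; map; replicate; foldl; foldr; concatMap; filter; length; applyUpTo)
import Data.List.Properties as List
open import Data.List.Relation.Unary.All using (All; []; _∷_)
import Data.List.Relation.Unary.All as All
open import Data.List.Relation.Binary.Pointwise using (Pointwise; []; _∷_)
open import Data.List.Relation.Binary.Permutation.Propositional using (_↭_; ↭-sym; ↭-prep; module PermutationReasoning)
open import Data.List.Relation.Binary.Permutation.Propositional.Properties using (++⁺ˡ; All-resp-↭; ↭-length) renaming (shift to ↭-shift)
open import Data.Bool using (Bool; true; false; if_then_else_; _∧_)
open import Data.Product using (_×_; _,_; proj₁; proj₂; ∃-syntax)
open import Data.Sum using (_⊎_; inj₁; inj₂)
open import Data.Empty using (⊥; ⊥-elim)
open import Function using (_∘_; id)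
open import Relation.Nullary using (Dec; yes; no)
open import Relation.Nullary.Decidable using (⌊_⌋)
open import Relation.Binary using (IsEquivalence; Setoid)
open import Relation.Binary.Definitions using (tri<; tri≈; tri>)
open import Relation.Binary.PropositionalEquality
import Relation.Binary.Reasoning.Setoid as SetoidReasoning
open import Level using (0ℓ)

module Polynomials where

  open import Data.Integer using (ℤ; +_; -[1+_]; _+_; _-_; _*_; 0ℤ; 1ℤ; -1ℤ; pred)
  import Data.Integer.Properties as ℤₚ
  open import Data.Integer.Tactic.RingSolver using (solve-∀)
  open import Algebra.Bundles using (CommutativeMonoid)
  open import Algebra.Structures using (IsCommutativeMonoid)
  import Algebra.Properties.CommutativeSemigroup as CommSemigroupProperties

  infix 4 _≈P_
  record _≈P_ (p q : Poly) : Set where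
    constructor mk≈
    field lookup-≡ : ∀ m → lookupD m p ≡ lookupD m q
  open _≈P_

  ≈P-isEquivalence : IsEquivalence _≈P_
  ≈P-isEquivalence = record
    { refl  = mk≈ λ _ → refl
    ; sym   = λ e → mk≈ λ m → sym (lookup-≡ e m)
    ; trans = λ e f → mk≈ λ m → trans (lookup-≡ e m) (lookup-≡ f m)
    }

  ≈P-setoid : Setoid 0ℓ 0ℓ
  ≈P-setoid = record { isEquivalence = ≈P-isEquivalence }

  open IsEquivalence ≈P-isEquivalence public
    using () renaming (refl to ≈P-refl; sym to ≈P-sym; trans to ≈P-trans; reflexive to ≡⇒≈P)

  module ≈P-Reasoning = SetoidReasoning ≈P-setoid

  shift : Poly → Poly
  shift p = + 0 ∷ p

  shiftBy : ℕ → Poly → Poly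
  shiftBy k p = replicate k (+ 0) ++ p

  lookupD-[] : ∀ m → lookupD m [] ≡ + 0
  lookupD-[] zero    = refl
  lookupD-[] (suc m) = refl

  lookupD-addP : ∀ m p q → lookupD m (addP p q) ≡ lookupD m p + lookupD m q
  lookupD-addP m       []      q       = sym (trans (cong (_+ lookupD m q) (lookupD-[] m)) (ℤₚ.+-identityˡ _))
  lookupD-addP m       (a ∷ p) []      =
    trans (sym (ℤₚ.+-identityʳ (lookupD m (a ∷ p)))) (cong (λ z → lookupD m (a ∷ p) + z) (sym (lookupD-[] m)))
  lookupD-addP zero    (a ∷ p) (b ∷ q) = refl
  lookupD-addP (suc m) (a ∷ p) (b ∷ q) = lookupD-addP m p q

  lookupD-scale : ∀ m a p → lookupD m (map (a *_) p) ≡ a * lookupD m p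
  lookupD-scale m       a []      = trans (lookupD-[] m) (trans (sym (ℤₚ.*-zeroʳ a)) (cong (a *_) (sym (lookupD-[] m))))
  lookupD-scale zero    a (x ∷ p) = refl
  lookupD-scale (suc m) a (x ∷ p) = lookupD-scale m a p

  lookupD-mulP : ∀ m a p q → lookupD m (mulP (a ∷ p) q) ≡ a * lookupD m q + lookupD m (shift (mulP p q))
  lookupD-mulP m a p q = trans (lookupD-addP m (map (a *_) q) (shift (mulP p q))) (cong (_+ _) (lookupD-scale m a q))

  addP-cong : ∀ {p p' q q'} → p ≈P p' → q ≈P q' → addP p q ≈P addP p' q'
  addP-cong {p} {p'} {q} {q'} e f = mk≈ λ m → begin
    lookupD m (addP p q)         ≡⟨ lookupD-addP m p q ⟩
    lookupD m p  + lookupD m q   ≡⟨ cong₂ _+_ (lookup-≡ e m) (lookup-≡ f m) ⟩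
    lookupD m p' + lookupD m q'  ≡⟨ lookupD-addP m p' q' ⟨
    lookupD m (addP p' q')       ∎
    where open ≡-Reasoning

  addP-comm : ∀ p q → addP p q ≈P addP q p
  addP-comm p q = mk≈ λ m →
    trans (lookupD-addP m p q) (trans (ℤₚ.+-comm (lookupD m p) _) (sym (lookupD-addP m q p)))

  addP-assoc : ∀ p q r → addP (addP p q) r ≈P addP p (addP q r)
  addP-assoc p q r = mk≈ λ m → begin
    lookupD m (addP (addP p q) r)                  ≡⟨ lookupD-addP m (addP p q) r ⟩
    lookupD m (addP p q) + lookupD m r             ≡⟨ cong (_+ lookupD m r) (lookupD-addP m p q) ⟩
    lookupD m p + lookupD m q + lookupD m r        ≡⟨ ℤₚ.+-assoc (lookupD m p) _ _ ⟩
    lookupD m p + (lookupD m q + lookupD m r)      ≡⟨ cong (λ z → lookupD m p + z) (lookupD-addP m q r) ⟨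
    lookupD m p + lookupD m (addP q r)             ≡⟨ lookupD-addP m p (addP q r) ⟨
    lookupD m (addP p (addP q r))                  ∎
    where open ≡-Reasoning

  addP-identityʳ : ∀ p → addP p [] ≈P p
  addP-identityʳ []      = ≈P-refl
  addP-identityʳ (x ∷ p) = ≈P-refl

  addP-isCommutativeMonoid : IsCommutativeMonoid _≈P_ addP []
  addP-isCommutativeMonoid = record
    { isMonoid = record
      { isSemigroup = record
        { isMagma = record { isEquivalence = ≈P-isEquivalence ; ∙-cong = addP-cong }
        ; assoc   = addP-assoc
        }
      ; identity = (λ _ → ≈P-refl) , addP-identityʳ
      }
    ; comm = addP-comm
    }

  addP-commutativeMonoid : CommutativeMonoid 0ℓ 0ℓ
  addP-commutativeMonoid = record { isCommutativeMonoid = addP-isCommutativeMonoid }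

  open CommSemigroupProperties (CommutativeMonoid.commutativeSemigroup addP-commutativeMonoid) public
    using () renaming (interchange to addP-interchange)

  shift-cong : ∀ {p q} → p ≈P q → shift p ≈P shift q
  shift-cong e = mk≈ λ { zero → refl ; (suc m) → lookup-≡ e m }

  shift-[] : shift [] ≈P []
  shift-[] = mk≈ λ { zero → refl ; (suc m) → refl }

  shift-addP : ∀ p q → shift (addP p q) ≈P addP (shift p) (shift q)
  shift-addP p q = mk≈ λ { zero → refl ; (suc m) → refl }

  shiftBy-cong : ∀ k {p q} → p ≈P q → shiftBy k p ≈P shiftBy k q
  shiftBy-cong zero    e = e
  shiftBy-cong (suc k) e = shift-cong (shiftBy-cong k e)

  shiftBy-addP : ∀ k p q → shiftBy k (addP p q) ≈P addP (shiftBy k p) (shiftBy k q)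
  shiftBy-addP zero    p q = ≈P-refl
  shiftBy-addP (suc k) p q = shift-cong (shiftBy-addP k p q)

  shiftBy-+ : ∀ j k p → shiftBy j (shiftBy k p) ≡ shiftBy (j ℕ.+ k) p
  shiftBy-+ zero    k p = refl
  shiftBy-+ (suc j) k p = cong shift (shiftBy-+ j k p)

  mulP-zeroˡ : ∀ {p} q → p ≈P [] → mulP p q ≈P []
  mulP-zeroˡ {[]}    q e = ≈P-refl
  mulP-zeroˡ {a ∷ p} q e = mk≈ λ m → begin
    lookupD m (mulP (a ∷ p) q)                 ≡⟨ lookupD-mulP m a p q ⟩
    a * lookupD m q + lookupD m (shift (mulP p q))
      ≡⟨ cong₂ _+_ (trans (cong (_* lookupD m q) (lookup-≡ e 0)) (ℤₚ.*-zeroˡ (lookupD m q)))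
                   (lookup-≡ (≈P-trans (shift-cong (mulP-zeroˡ {p} q (mk≈ λ k → lookup-≡ e (suc k)))) shift-[]) m) ⟩
    0ℤ + lookupD m []                          ≡⟨ ℤₚ.+-identityˡ _ ⟩
    lookupD m []                               ∎
    where open ≡-Reasoning

  mulP-congˡ : ∀ {p p'} q → p ≈P p' → mulP p q ≈P mulP p' q
  mulP-congˡ {[]}    {p'}     q e = ≈P-sym (mulP-zeroˡ q (≈P-sym e))
  mulP-congˡ {a ∷ p} {[]}     q e = mulP-zeroˡ q e
  mulP-congˡ {a ∷ p} {b ∷ p'} q e = mk≈ λ m → begin
    lookupD m (mulP (a ∷ p) q)                        ≡⟨ lookupD-mulP m a p q ⟩
    a * lookupD m q + lookupD m (shift (mulP p q))
      ≡⟨ cong₂ _+_ (cong (_* lookupD m q) (lookup-≡ e 0))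
                   (lookup-≡ (shift-cong (mulP-congˡ {p} {p'} q (mk≈ λ k → lookup-≡ e (suc k)))) m) ⟩
    b * lookupD m q + lookupD m (shift (mulP p' q))   ≡⟨ lookupD-mulP m b p' q ⟨
    lookupD m (mulP (b ∷ p') q)                       ∎
    where open ≡-Reasoning

  mulP-shiftˡ : ∀ p q → mulP (shift p) q ≈P shift (mulP p q)
  mulP-shiftˡ p q = mk≈ λ m → trans (lookupD-mulP m (+ 0) p q)
    (trans (cong (_+ lookupD m (shift (mulP p q))) (ℤₚ.*-zeroˡ (lookupD m q))) (ℤₚ.+-identityˡ _))

  mulP-identityˡ : ∀ q → mulP (+ 1 ∷ []) q ≈P q
  mulP-identityˡ q = mk≈ λ m → begin
    lookupD m (mulP (+ 1 ∷ []) q)                ≡⟨ lookupD-mulP m (+ 1) [] q ⟩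
    + 1 * lookupD m q + lookupD m (shift [])     ≡⟨ cong₂ _+_ (ℤₚ.*-identityˡ (lookupD m q)) (lookup-≡ shift-[] m) ⟩
    lookupD m q + lookupD m []                   ≡⟨ cong (λ z → lookupD m q + z) (lookupD-[] m) ⟩
    lookupD m q + 0ℤ                             ≡⟨ ℤₚ.+-identityʳ (lookupD m q) ⟩
    lookupD m q                                  ∎
    where open ≡-Reasoning

  scale-cong : ∀ a {q q'} → q ≈P q' → map (a *_) q ≈P map (a *_) q'
  scale-cong a {q} {q'} e = mk≈ λ m →
    trans (lookupD-scale m a q) (trans (cong (a *_) (lookup-≡ e m)) (sym (lookupD-scale m a q')))

  scale-distribʳ : ∀ a b q → map ((a + b) *_) q ≈P addP (map (a *_) q) (map (b *_) q)
  scale-distribʳ a b q = mk≈ λ m → begin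
    lookupD m (map ((a + b) *_) q)                              ≡⟨ lookupD-scale m (a + b) q ⟩
    (a + b) * lookupD m q                                       ≡⟨ ℤₚ.*-distribʳ-+ (lookupD m q) a b ⟩
    a * lookupD m q + b * lookupD m q                           ≡⟨ cong₂ _+_ (lookupD-scale m a q) (lookupD-scale m b q) ⟨
    lookupD m (map (a *_) q) + lookupD m (map (b *_) q)         ≡⟨ lookupD-addP m (map (a *_) q) (map (b *_) q) ⟨
    lookupD m (addP (map (a *_) q) (map (b *_) q))              ∎
    where open ≡-Reasoning

  mulP-distribʳ : ∀ p p' q → mulP (addP p p') q ≈P addP (mulP p q) (mulP p' q)
  mulP-distribʳ []      p'       q = ≈P-refl
  mulP-distribʳ (a ∷ p) []       q = ≈P-sym (addP-identityʳ _)
  mulP-distribʳ (a ∷ p) (b ∷ p') q = begin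
    addP (map ((a + b) *_) q) (shift (mulP (addP p p') q))
      ≈⟨ addP-cong (scale-distribʳ a b q) (≈P-trans (shift-cong (mulP-distribʳ p p' q)) (shift-addP (mulP p q) (mulP p' q))) ⟩
    addP (addP (map (a *_) q) (map (b *_) q)) (addP (shift (mulP p q)) (shift (mulP p' q)))
      ≈⟨ addP-interchange (map (a *_) q) (map (b *_) q) (shift (mulP p q)) (shift (mulP p' q)) ⟩
    addP (mulP (a ∷ p) q) (mulP (b ∷ p') q)     ∎
    where open ≈P-Reasoning

  mulP-monoP : ∀ k q → mulP (monoP k) q ≈P shiftBy k q
  mulP-monoP zero    q = mulP-identityˡ q
  mulP-monoP (suc k) q = ≈P-trans (mulP-shiftˡ (monoP k) q) (shift-cong (mulP-monoP k q))

  mulP-shiftByˡ : ∀ j p q → mulP (shiftBy j p) q ≈P shiftBy j (mulP p q)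
  mulP-shiftByˡ zero    p q = ≈P-refl
  mulP-shiftByˡ (suc j) p q = ≈P-trans (mulP-shiftˡ (shiftBy j p) q) (shift-cong (mulP-shiftByˡ j p q))

  mulP-congʳ : ∀ p {q q'} → q ≈P q' → mulP p q ≈P mulP p q'
  mulP-congʳ []      e = ≈P-refl
  mulP-congʳ (a ∷ p) e = addP-cong (scale-cong a e) (shift-cong (mulP-congʳ p e))

  mulP-shiftʳ : ∀ p q → mulP p (shift q) ≈P shift (mulP p q)
  mulP-shiftʳ []      q = ≈P-sym shift-[]
  mulP-shiftʳ (a ∷ p) q = ≈P-trans
    (addP-cong {map (a *_) (shift q)} {shift (map (a *_) q)} (mk≈ λ { zero → ℤₚ.*-zeroʳ a ; (suc m) → refl })
               (shift-cong (mulP-shiftʳ p q)))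
    (≈P-sym (shift-addP (map (a *_) q) (shift (mulP p q))))

  mulP-shiftByʳ : ∀ p k q → mulP p (shiftBy k q) ≈P shiftBy k (mulP p q)
  mulP-shiftByʳ p zero    q = ≈P-refl
  mulP-shiftByʳ p (suc k) q = ≈P-trans (mulP-shiftʳ p (shiftBy k q)) (shift-cong (mulP-shiftByʳ p k q))

  ≈L-refl : ∀ {x} → x ≈L x
  ≈L-refl _ = refl

  ≈L-sym : ∀ {x y} → x ≈L y → y ≈L x
  ≈L-sym e k = sym (e k)

  ≈L-trans : ∀ {x y z} → x ≈L y → y ≈L z → x ≈L z
  ≈L-trans e f k = trans (e k) (f k)

  lookupℤ : Poly → ℤ → ℤ
  lookupℤ c (+ m)    = lookupD m c
  lookupℤ c -[1+ m ] = 0ℤ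

  coeffL-lookupℤ : ∀ s c k → coeffL (s , c) k ≡ lookupℤ c (k + + s)
  coeffL-lookupℤ s c k with k + + s
  ... | + m      = refl
  ... | -[1+ m ] = refl

  lookupℤ-cong : ∀ {p q} → p ≈P q → ∀ z → lookupℤ p z ≡ lookupℤ q z
  lookupℤ-cong e (+ m)    = lookup-≡ e m
  lookupℤ-cong e -[1+ m ] = refl

  lookupℤ-[] : ∀ z → lookupℤ [] z ≡ 0ℤ
  lookupℤ-[] (+ m)    = lookupD-[] m
  lookupℤ-[] -[1+ m ] = refl

  lookupℤ-addP : ∀ p q z → lookupℤ (addP p q) z ≡ lookupℤ p z + lookupℤ q z
  lookupℤ-addP p q (+ m)    = lookupD-addP m p q
  lookupℤ-addP p q -[1+ m ] = refl

  lookupℤ-shift : ∀ p z → lookupℤ (shift p) z ≡ lookupℤ p (pred z)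
  lookupℤ-shift p (+ zero)  = refl
  lookupℤ-shift p (+ suc m) = refl
  lookupℤ-shift p -[1+ m ]  = refl

  lookupℤ-shiftBy : ∀ k p z → lookupℤ (shiftBy k p) z ≡ lookupℤ p (z - + k)
  lookupℤ-shiftBy zero    p z = cong (lookupℤ p) (sym (ℤₚ.+-identityʳ z))
  lookupℤ-shiftBy (suc k) p z = begin
    lookupℤ (shift (shiftBy k p)) z  ≡⟨ lookupℤ-shift (shiftBy k p) z ⟩
    lookupℤ (shiftBy k p) (pred z)   ≡⟨ lookupℤ-shiftBy k p (pred z) ⟩
    lookupℤ p (pred z - + k)         ≡⟨ cong (lookupℤ p) (shuffle z (+ k)) ⟩
    lookupℤ p (z - + suc k)          ∎
    where
    open ≡-Reasoning
    shuffle : ∀ z k → -1ℤ + z - k ≡ z - (1ℤ + k)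
    shuffle = solve-∀

  lookupℤ-mulP : ∀ a p q z → lookupℤ (mulP (a ∷ p) q) z ≡ a * lookupℤ q z + lookupℤ (mulP p q) (pred z)
  lookupℤ-mulP a p q (+ m) =
    trans (lookupD-mulP m a p q) (cong (λ y → a * lookupD m q + y) (lookupℤ-shift (mulP p q) (+ m)))
  lookupℤ-mulP a p q -[1+ m ] = sym (cong (_+ 0ℤ) (ℤₚ.*-zeroʳ a))

  coeffL-addL : ∀ x y k → coeffL (addL x y) k ≡ coeffL x k + coeffL y k
  coeffL-addL (s₁ , c₁) (s₂ , c₂) k = begin
    coeffL (addL (s₁ , c₁) (s₂ , c₂)) k
      ≡⟨ coeffL-lookupℤ (s₁ ℕ.+ s₂) _ k ⟩
    lookupℤ (addP (mulP (monoP s₂) c₁) (mulP (monoP s₁) c₂)) z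
      ≡⟨ lookupℤ-addP (mulP (monoP s₂) c₁) (mulP (monoP s₁) c₂) z ⟩
    lookupℤ (mulP (monoP s₂) c₁) z + lookupℤ (mulP (monoP s₁) c₂) z
      ≡⟨ cong₂ _+_ (lookupℤ-cong (mulP-monoP s₂ c₁) z) (lookupℤ-cong (mulP-monoP s₁ c₂) z) ⟩
    lookupℤ (shiftBy s₂ c₁) z + lookupℤ (shiftBy s₁ c₂) z
      ≡⟨ cong₂ _+_ (lookupℤ-shiftBy s₂ c₁ z) (lookupℤ-shiftBy s₁ c₂ z) ⟩
    lookupℤ c₁ (z - + s₂) + lookupℤ c₂ (z - + s₁)
      ≡⟨ cong₂ _+_ (cong (lookupℤ c₁) (cancel₂ k (+ s₁) (+ s₂))) (cong (lookupℤ c₂) (cancel₁ k (+ s₁) (+ s₂))) ⟩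
    lookupℤ c₁ (k + + s₁) + lookupℤ c₂ (k + + s₂)
      ≡⟨ cong₂ _+_ (coeffL-lookupℤ s₁ c₁ k) (coeffL-lookupℤ s₂ c₂ k) ⟨
    coeffL (s₁ , c₁) k + coeffL (s₂ , c₂) k ∎
    where
    open ≡-Reasoning
    z : ℤ
    z = k + + (s₁ ℕ.+ s₂)
    cancel₁ : ∀ k a b → k + (a + b) - a ≡ k + b
    cancel₁ = solve-∀
    cancel₂ : ∀ k a b → k + (a + b) - b ≡ k + a
    cancel₂ = solve-∀

  -- tMinusTinv computes to (1 , -1ℤ ∷ 0ℤ ∷ 1ℤ ∷ []), that is t⁻¹ (t² − 1)
  coeffL-mulT : ∀ x k → coeffL (mulL tMinusTinv x) k ≡ coeffL x (pred k) - coeffL x (1ℤ + k)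
  coeffL-mulT (s , c) k = begin
    coeffL (mulL tMinusTinv (s , c)) k
      ≡⟨ coeffL-lookupℤ (suc s) (mulP (-1ℤ ∷ 0ℤ ∷ 1ℤ ∷ []) c) k ⟩
    lookupℤ (mulP (-1ℤ ∷ 0ℤ ∷ 1ℤ ∷ []) c) z
      ≡⟨ lookupℤ-mulP₃ -1ℤ 0ℤ 1ℤ c z ⟩
    -1ℤ * lookupℤ c z + (0ℤ * lookupℤ c (pred z) + (1ℤ * lookupℤ c (pred (pred z)) + 0ℤ))
      ≡⟨ collect (lookupℤ c z) (lookupℤ c (pred z)) (lookupℤ c (pred (pred z))) ⟩
    lookupℤ c (pred (pred z)) - lookupℤ c z
      ≡⟨ cong₂ _-_ (cong (lookupℤ c) (below k (+ s))) (cong (lookupℤ c) (above k (+ s))) ⟩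
    lookupℤ c (pred k + + s) - lookupℤ c (1ℤ + k + + s)
      ≡⟨ cong₂ _-_ (coeffL-lookupℤ s c (pred k)) (coeffL-lookupℤ s c (1ℤ + k)) ⟨
    coeffL (s , c) (pred k) - coeffL (s , c) (1ℤ + k) ∎
    where
    open ≡-Reasoning
    z : ℤ
    z = k + + suc s
    lookupℤ-mulP₃ : ∀ a b d q z → lookupℤ (mulP (a ∷ b ∷ d ∷ []) q) z
                    ≡ a * lookupℤ q z + (b * lookupℤ q (pred z) + (d * lookupℤ q (pred (pred z)) + 0ℤ))
    lookupℤ-mulP₃ a b d q z =
      trans (lookupℤ-mulP a (b ∷ d ∷ []) q z) (cong (λ y → a * lookupℤ q z + y)
      (trans (lookupℤ-mulP b (d ∷ []) q (pred z)) (cong (λ y → b * lookupℤ q (pred z) + y)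
      (trans (lookupℤ-mulP d [] q (pred (pred z))) (cong (λ y → d * lookupℤ q (pred (pred z)) + y)
      (lookupℤ-[] (pred (pred (pred z)))))))))
    collect : ∀ a b d → -1ℤ * a + (0ℤ * b + (1ℤ * d + 0ℤ)) ≡ d - a
    collect = solve-∀
    below : ∀ x y → -1ℤ + (-1ℤ + (x + (1ℤ + y))) ≡ -1ℤ + x + y
    below = solve-∀
    above : ∀ x y → x + (1ℤ + y) ≡ 1ℤ + x + y
    above = solve-∀

  addL-cong : ∀ {x x' y y'} → x ≈L x' → y ≈L y' → addL x y ≈L addL x' y'
  addL-cong {x} {x'} {y} {y'} e f k =
    trans (coeffL-addL x y k) (trans (cong₂ _+_ (e k) (f k)) (sym (coeffL-addL x' y' k)))

  mulT-cong : ∀ {x y} → x ≈L y → mulL tMinusTinv x ≈L mulL tMinusTinv y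
  mulT-cong {x} {y} e k =
    trans (coeffL-mulT x k) (trans (cong₂ _-_ (e (pred k)) (e (1ℤ + k))) (sym (coeffL-mulT y k)))

  evalT : Poly → Laurent
  evalT p = evalAt p tMinusTinv

  coeffL-constL : ∀ a k → coeffL (constL a) k ≡ lookupℤ (a ∷ []) k
  coeffL-constL a k = trans (coeffL-lookupℤ 0 (a ∷ []) k) (cong (lookupℤ (a ∷ [])) (ℤₚ.+-identityʳ k))

  coeffL-evalT-[] : ∀ k → coeffL (evalT []) k ≡ 0ℤ
  coeffL-evalT-[] k = trans (coeffL-constL 0ℤ k) (trans (lookupℤ-cong zero≈[] k) (lookupℤ-[] k))
    where
    zero≈[] : 0ℤ ∷ [] ≈P []
    zero≈[] = mk≈ λ { zero → refl ; (suc m) → refl }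

  coeffL-evalT-∷ : ∀ a p k →
    coeffL (evalT (a ∷ p)) k ≡ lookupℤ (a ∷ []) k + (coeffL (evalT p) (pred k) - coeffL (evalT p) (1ℤ + k))
  coeffL-evalT-∷ a p k = trans (coeffL-addL (constL a) _ k) (cong₂ _+_ (coeffL-constL a k) (coeffL-mulT (evalT p) k))

  coeffL-evalT-zero : ∀ {p} → p ≈P [] → ∀ k → coeffL (evalT p) k ≡ 0ℤ
  coeffL-evalT-zero {[]}    e k = coeffL-evalT-[] k
  coeffL-evalT-zero {a ∷ p} e k = begin
    coeffL (evalT (a ∷ p)) k
      ≡⟨ coeffL-evalT-∷ a p k ⟩
    lookupℤ (a ∷ []) k + (coeffL (evalT p) (pred k) - coeffL (evalT p) (1ℤ + k))
      ≡⟨ cong₂ (λ u v → u + (v - coeffL (evalT p) (1ℤ + k))) (lookupℤ-cong head≈[] k) (coeffL-evalT-zero tail≈[] (pred k)) ⟩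
    lookupℤ [] k + (0ℤ - coeffL (evalT p) (1ℤ + k))
      ≡⟨ cong₂ (λ u v → u + (0ℤ - v)) (lookupℤ-[] k) (coeffL-evalT-zero tail≈[] (1ℤ + k)) ⟩
    0ℤ ∎
    where
    open ≡-Reasoning
    head≈[] : a ∷ [] ≈P []
    head≈[] = mk≈ λ { zero → lookup-≡ e 0 ; (suc m) → refl }
    tail≈[] : p ≈P []
    tail≈[] = mk≈ λ m → lookup-≡ e (suc m)

  evalT-cong : ∀ {p q} → p ≈P q → evalT p ≈L evalT q
  evalT-cong {[]}    {q}     e k = trans (coeffL-evalT-[] k) (sym (coeffL-evalT-zero (≈P-sym e) k))
  evalT-cong {a ∷ p} {[]}    e k = trans (coeffL-evalT-zero e k) (sym (coeffL-evalT-[] k))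
  evalT-cong {a ∷ p} {b ∷ q} e   = addL-cong (λ k → cong (λ c → coeffL (constL c) k) (lookup-≡ e 0))
                                             (mulT-cong (evalT-cong {p} {q} (mk≈ λ m → lookup-≡ e (suc m))))

  evalT-addP : ∀ p q → evalT (addP p q) ≈L addL (evalT p) (evalT q)
  evalT-addP []      q k = sym (trans (coeffL-addL (evalT []) (evalT q) k)
                                      (trans (cong (_+ coeffL (evalT q) k) (coeffL-evalT-[] k)) (ℤₚ.+-identityˡ _)))
  evalT-addP (a ∷ p) [] k = sym (trans (coeffL-addL (evalT (a ∷ p)) (evalT []) k)
                                       (trans (cong (λ v → coeffL (evalT (a ∷ p)) k + v) (coeffL-evalT-[] k)) (ℤₚ.+-identityʳ _)))
  evalT-addP (a ∷ p) (b ∷ q) k = begin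
    coeffL (evalT (a + b ∷ addP p q)) k
      ≡⟨ coeffL-evalT-∷ (a + b) (addP p q) k ⟩
    lookupℤ (a + b ∷ []) k + (coeffL (evalT (addP p q)) (pred k) - coeffL (evalT (addP p q)) (1ℤ + k))
      ≡⟨ cong₂ (λ u v → u + v) (lookupℤ-addP (a ∷ []) (b ∷ []) k)
               (cong₂ _-_ (trans (evalT-addP p q (pred k)) (coeffL-addL (evalT p) (evalT q) (pred k)))
                          (trans (evalT-addP p q (1ℤ + k)) (coeffL-addL (evalT p) (evalT q) (1ℤ + k)))) ⟩
    A + B + (P₋ + Q₋ - (P₊ + Q₊))
      ≡⟨ regroup A B P₋ Q₋ P₊ Q₊ ⟩
    (A + (P₋ - P₊)) + (B + (Q₋ - Q₊))
      ≡⟨ cong₂ _+_ (coeffL-evalT-∷ a p k) (coeffL-evalT-∷ b q k) ⟨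
    coeffL (evalT (a ∷ p)) k + coeffL (evalT (b ∷ q)) k
      ≡⟨ coeffL-addL (evalT (a ∷ p)) (evalT (b ∷ q)) k ⟨
    coeffL (addL (evalT (a ∷ p)) (evalT (b ∷ q))) k ∎
    where
    open ≡-Reasoning
    A B P₋ Q₋ P₊ Q₊ : ℤ
    A = lookupℤ (a ∷ []) k
    B = lookupℤ (b ∷ []) k
    P₋ = coeffL (evalT p) (pred k)
    Q₋ = coeffL (evalT q) (pred k)
    P₊ = coeffL (evalT p) (1ℤ + k)
    Q₊ = coeffL (evalT q) (1ℤ + k)
    regroup : ∀ a b p₋ q₋ p₊ q₊ → a + b + (p₋ + q₋ - (p₊ + q₊)) ≡ (a + (p₋ - p₊)) + (b + (q₋ - q₊))
    regroup = solve-∀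

  evalT-shift : ∀ p → evalT (shift p) ≈L mulL tMinusTinv (evalT p)
  evalT-shift p k = trans (coeffL-addL (constL 0ℤ) _ k)
    (trans (cong (_+ coeffL (mulL tMinusTinv (evalT p)) k) (coeffL-evalT-[] k)) (ℤₚ.+-identityˡ _))

  evalT-one : constL 1ℤ ≈L evalT (monoP 0)
  evalT-one k = sym (trans (coeffL-evalT-∷ 1ℤ [] k)
    (trans (cong (λ v → lookupℤ (1ℤ ∷ []) k + (v - coeffL (evalT []) (1ℤ + k))) (coeffL-evalT-[] (pred k)))
    (trans (cong (λ v → lookupℤ (1ℤ ∷ []) k + (0ℤ - v)) (coeffL-evalT-[] (1ℤ + k)))
    (trans (ℤₚ.+-identityʳ _) (sym (coeffL-constL 1ℤ k))))))

open Polynomials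
open import Data.Nat using (_+_)

ascends : Perm → ℕ → Bool
ascends u i = len u <ᵇ len (rmul u i)

-- The coefficient of H_e in (t − t⁻¹)^k H_u H_{s_{i₁}}⁻¹ ⋯ H_{s_{iₘ}}⁻¹, as a polynomial in t − t⁻¹.
pathSum : ℕ → Perm → ℕ → List ℕ → Poly
pathSum n u k [] with List.≡-dec ℕ._≟_ (idP n) u
... | yes _ = monoP k
... | no  _ = []
pathSum n u k (i ∷ w) = addP (pathSum n (rmul u i) k w) (if ascends u i then pathSum n u (suc k) w else [])

pathSum-ascent : ∀ n u k i w → ascends u i ≡ true →
                 pathSum n u k (i ∷ w) ≡ addP (pathSum n (rmul u i) k w) (pathSum n u (suc k) w)
pathSum-ascent n u k i w up rewrite up = refl

pathSum-descent : ∀ n u k i w → ascends u i ≡ false → pathSum n u k (i ∷ w) ≈P pathSum n (rmul u i) k w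
pathSum-descent n u k i w down rewrite down = addP-identityʳ _

-- (u , k) stands for (t − t⁻¹)^k H_u
MonomialElt : Set
MonomialElt = List (Perm × ℕ)

rmulHinvᴹ-single : ℕ → Perm × ℕ → MonomialElt
rmulHinvᴹ-single i (u , k) = if ascends u i then (rmul u i , k) ∷ (u , suc k) ∷ [] else (rmul u i , k) ∷ []

rmulHinvᴹ : MonomialElt → ℕ → MonomialElt
rmulHinvᴹ h i = concatMap (rmulHinvᴹ-single i) h

Denotes : Perm × Laurent → Perm × ℕ → Set
Denotes (u , c) (v , k) = u ≡ v × c ≈L evalT (monoP k)

rmulHinv-∷ : ∀ u c h i → rmulHinv ((u , c) ∷ h) i
  ≡ (if ascends u i then (rmul u i , c) ∷ (u , mulL tMinusTinv c) ∷ [] else (rmul u i , c) ∷ []) ++ rmulHinv h i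
rmulHinv-∷ u c h i with ascends u i
... | true  = refl
... | false = refl

rmulHinv-denotes : ∀ {h hs} i → Pointwise Denotes h hs → Pointwise Denotes (rmulHinv h i) (rmulHinvᴹ hs i)
rmulHinv-denotes i [] = []
rmulHinv-denotes {(u , c) ∷ h} {(.u , k) ∷ hs} i ((refl , c≈) ∷ rest)
  rewrite rmulHinv-∷ u c h i with ascends u i
... | true  = (refl , c≈) ∷ (refl , ≈L-trans (mulT-cong c≈) (≈L-sym (evalT-shift (monoP k)))) ∷ rmulHinv-denotes i rest
... | false = (refl , c≈) ∷ rmulHinv-denotes i rest

pathSums : ℕ → MonomialElt → List ℕ → Poly
pathSums n []              w = []
pathSums n ((u , k) ∷ hs) w = addP (pathSum n u k w) (pathSums n hs w)

coeffH-denotes : ∀ n {h hs} → Pointwise Denotes h hs → coeffH (idP n) h ≈L evalT (pathSums n hs [])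
coeffH-denotes n [] = ≈L-refl
coeffH-denotes n {(u , c) ∷ h} {(.u , k) ∷ hs} ((refl , c≈) ∷ rest) with List.≡-dec ℕ._≟_ (idP n) u
... | yes _ = ≈L-trans (addL-cong c≈ (coeffH-denotes n rest)) (≈L-sym (evalT-addP (monoP k) (pathSums n hs [])))
... | no  _ = coeffH-denotes n rest

pathSums-++ : ∀ n a b w → pathSums n (a ++ b) w ≈P addP (pathSums n a w) (pathSums n b w)
pathSums-++ n []             b w = ≈P-refl
pathSums-++ n ((u , k) ∷ a) b w =
  ≈P-trans (addP-cong (≈P-refl {pathSum n u k w}) (pathSums-++ n a b w))
           (≈P-sym (addP-assoc (pathSum n u k w) (pathSums n a w) (pathSums n b w)))

pathSums-rmulHinvᴹ : ∀ n hs i w → pathSums n (rmulHinvᴹ hs i) w ≈P pathSums n hs (i ∷ w)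
pathSums-rmulHinvᴹ n []             i w = ≈P-refl
pathSums-rmulHinvᴹ n ((u , k) ∷ hs) i w = begin
  pathSums n (rmulHinvᴹ ((u , k) ∷ hs) i) w
    ≈⟨ pathSums-++ n (rmulHinvᴹ-single i (u , k)) (rmulHinvᴹ hs i) w ⟩
  addP (pathSums n (rmulHinvᴹ-single i (u , k)) w) (pathSums n (rmulHinvᴹ hs i) w)
    ≈⟨ addP-cong step (pathSums-rmulHinvᴹ n hs i w) ⟩
  pathSums n ((u , k) ∷ hs) (i ∷ w) ∎
  where
  open ≈P-Reasoning
  step : pathSums n (rmulHinvᴹ-single i (u , k)) w ≈P pathSum n u k (i ∷ w)
  step with ascends u i
  ... | true  = addP-cong (≈P-refl {pathSum n (rmul u i) k w}) (addP-identityʳ _)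
  ... | false = ≈P-refl

pathSums-foldl : ∀ n w hs → pathSums n (foldl rmulHinvᴹ hs w) [] ≈P pathSums n hs w
pathSums-foldl n []      hs = ≈P-refl
pathSums-foldl n (i ∷ w) hs = ≈P-trans (pathSums-foldl n w (rmulHinvᴹ hs i)) (pathSums-rmulHinvᴹ n hs i w)

foldl-denotes : ∀ {h hs} w → Pointwise Denotes h hs → Pointwise Denotes (foldl rmulHinv h w) (foldl rmulHinvᴹ hs w)
foldl-denotes []      r = r
foldl-denotes (i ∷ w) r = foldl-denotes w (rmulHinv-denotes i r)

Rev≈pathSum : ∀ n w → Rev n w ≈L evalT (pathSum n (idP n) 0 w)
Rev≈pathSum n w = ≈L-trans
  (coeffH-denotes n (foldl-denotes w ((refl , evalT-one) ∷ [])))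
  (evalT-cong (≈P-trans (pathSums-foldl n w ((idP n , 0) ∷ [])) (addP-identityʳ (pathSum n (idP n) 0 w))))

swap : ℕ → ℕ → ℕ
swap zero    zero          = suc zero
swap zero    (suc zero)    = zero
swap zero    (suc (suc p)) = suc (suc p)
swap (suc i) zero          = zero
swap (suc i) (suc p)       = suc (swap i p)

swap-involutive : ∀ i p → swap i (swap i p) ≡ p
swap-involutive zero    zero          = refl
swap-involutive zero    (suc zero)    = refl
swap-involutive zero    (suc (suc p)) = refl
swap-involutive (suc i) zero          = refl
swap-involutive (suc i) (suc p)       = cong suc (swap-involutive i p)

swap-left : ∀ i → swap i i ≡ suc i
swap-left zero    = refl
swap-left (suc i) = cong suc (swap-left i)

swap-right : ∀ i → swap i (suc i) ≡ i
swap-right zero    = refl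
swap-right (suc i) = cong suc (swap-right i)

swap-≡-left : ∀ i p → swap i p ≡ i → p ≡ suc i
swap-≡-left i p eq = trans (sym (swap-involutive i p)) (trans (cong (swap i) eq) (swap-left i))

swap-≡-right : ∀ i p → swap i p ≡ suc i → p ≡ i
swap-≡-right i p eq = trans (sym (swap-involutive i p)) (trans (cong (swap i) eq) (swap-right i))

swap-fixed : ∀ i p → p ≢ i → p ≢ suc i → swap i p ≡ p
swap-fixed zero    zero          p≢i p≢1+i = ⊥-elim (p≢i refl)
swap-fixed zero    (suc zero)    p≢i p≢1+i = ⊥-elim (p≢1+i refl)
swap-fixed zero    (suc (suc p)) p≢i p≢1+i = refl
swap-fixed (suc i) zero          p≢i p≢1+i = refl
swap-fixed (suc i) (suc p)       p≢i p≢1+i = cong suc (swap-fixed i p (p≢i ∘ cong suc) (p≢1+i ∘ cong suc))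

swap-≤ : ∀ x c p → x ≢ c → p ≤ c → swap x p ≤ c
swap-≤ zero    zero    zero          x≢c p≤c = ⊥-elim (x≢c refl)
swap-≤ zero    (suc c) zero          x≢c p≤c = s≤s z≤n
swap-≤ zero    c       (suc zero)    x≢c p≤c = z≤n
swap-≤ zero    c       (suc (suc p)) x≢c p≤c = p≤c
swap-≤ (suc x) c       zero          x≢c p≤c = z≤n
swap-≤ (suc x) (suc c) (suc p)       x≢c (s≤s p≤c) = s≤s (swap-≤ x c p (x≢c ∘ cong suc) p≤c)

swap-≤-suc : ∀ x c p → p ≤ c → swap x p ≤ suc c
swap-≤-suc zero    c       zero          p≤c = s≤s z≤n
swap-≤-suc zero    c       (suc zero)    p≤c = z≤n
swap-≤-suc zero    c       (suc (suc p)) p≤c = ℕₚ.m≤n⇒m≤1+n p≤c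
swap-≤-suc (suc x) c       zero          p≤c = z≤n
swap-≤-suc (suc x) (suc c) (suc p)       (s≤s p≤c) = s≤s (swap-≤-suc x c p p≤c)

swap-≥ : ∀ x m p → suc x ≢ m → m ≤ p → m ≤ swap x p
swap-≥ x       zero          p             1+x≢m m≤p = z≤n
swap-≥ zero    (suc zero)    p             1+x≢m m≤p = ⊥-elim (1+x≢m refl)
swap-≥ zero    (suc (suc m)) (suc zero)    1+x≢m (s≤s ())
swap-≥ zero    (suc (suc m)) (suc (suc p)) 1+x≢m m≤p = m≤p
swap-≥ (suc x) (suc m)       (suc p)       1+x≢m (s≤s m≤p) = s≤s (swap-≥ x m p (1+x≢m ∘ cong suc) m≤p)

swap-≥-pred : ∀ x m p → suc m ≤ p → m ≤ swap x p
swap-≥-pred x       zero    p             m<p = z≤n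
swap-≥-pred zero    (suc m) (suc (suc p)) (s≤s m<p) = ℕₚ.m≤n⇒m≤1+n m<p
swap-≥-pred (suc x) (suc m) (suc p)       (s≤s m<p) = s≤s (swap-≥-pred x m p m<p)

swap-< : ∀ x n p → suc x < n → p < n → swap x p < n
swap-< zero    n       zero          1+x<n p<n = 1+x<n
swap-< zero    n       (suc zero)    1+x<n p<n = ℕₚ.<-trans (s≤s z≤n) 1+x<n
swap-< zero    n       (suc (suc p)) 1+x<n p<n = p<n
swap-< (suc x) n       zero          1+x<n p<n = p<n
swap-< (suc x) (suc n) (suc p)       (s≤s 1+x<n) (s≤s p<n) = s≤s (swap-< x n p 1+x<n p<n)

-- A permutation in one-line notation is handled as applyUpTo g n, with g acting on positions.
rmul-applyUpTo : ∀ (g : ℕ → ℕ) n i → suc i < n → rmul (applyUpTo g n) i ≡ applyUpTo (g ∘ swap i) n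
rmul-applyUpTo g (suc zero)    zero    (s≤s ())
rmul-applyUpTo g (suc (suc m)) zero    1+i<n       = refl
rmul-applyUpTo g (suc (suc m)) (suc i) (s≤s 1+i<n) = cong (g 0 ∷_) (rmul-applyUpTo (g ∘ suc) (suc m) i 1+i<n)

applyUpTo-cong : ∀ {A : Set} {f g : ℕ → A} n → (∀ q → q < n → f q ≡ g q) → applyUpTo f n ≡ applyUpTo g n
applyUpTo-cong zero    f≗g = refl
applyUpTo-cong (suc n) f≗g = cong₂ _∷_ (f≗g 0 (s≤s z≤n)) (applyUpTo-cong n (λ q q<n → f≗g (suc q) (s≤s q<n)))

applyUpTo-injective : ∀ {A : Set} (f g : ℕ → A) n → applyUpTo f n ≡ applyUpTo g n → ∀ p → p < n → f p ≡ g p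
applyUpTo-injective f g (suc n) eq zero    p<n       = cong (λ { [] → f 0 ; (x ∷ _) → x }) eq
applyUpTo-injective f g (suc n) eq (suc p) (s≤s p<n) =
  applyUpTo-injective (f ∘ suc) (g ∘ suc) n (cong (λ { [] → [] ; (_ ∷ xs) → xs }) eq) p p<n

applyUpTo-splitAt : ∀ {A : Set} (h : ℕ → A) m x → x < m →
  applyUpTo h m ≡ applyUpTo h x ++ h x ∷ applyUpTo (h ∘ (suc x +_)) (m ∸ suc x)
applyUpTo-splitAt h (suc m) zero    _         = refl
applyUpTo-splitAt h (suc m) (suc x) (s≤s x<m) = cong (h 0 ∷_) (applyUpTo-splitAt (h ∘ suc) m x x<m)

applyUpTo-update : ∀ {A : Set} (h h' : ℕ → A) m x → x < m → (∀ q → q ≢ x → h' q ≡ h q) →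
  applyUpTo h' m ≡ applyUpTo h x ++ h' x ∷ applyUpTo (h ∘ (suc x +_)) (m ∸ suc x)
applyUpTo-update h h' m x x<m agree = trans (applyUpTo-splitAt h' m x x<m) (cong₂ (λ a b → a ++ h' x ∷ b)
  (applyUpTo-cong x (λ q q<x → agree q (ℕₚ.<⇒≢ q<x)))
  (applyUpTo-cong (m ∸ suc x) (λ q _ → agree (suc x + q) (ℕₚ.>⇒≢ (ℕₚ.m≤m+n (suc x) q)))))

idP≢applyUpTo : ∀ n (g : ℕ → ℕ) p → p < n → g p ≢ p → idP n ≢ applyUpTo g n
idP≢applyUpTo n g p p<n gp≢p eq = gp≢p (sym (applyUpTo-injective id g n eq p p<n))

countLess-rmul : ∀ x xs i → countLess x (rmul xs i) ≡ countLess x xs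
countLess-rmul x []           i       = refl
countLess-rmul x (y ∷ [])     i       = refl
countLess-rmul x (y ∷ z ∷ xs) zero    = +-left-comm (if z <ᵇ x then 1 else 0) (if y <ᵇ x then 1 else 0) (countLess x xs)
countLess-rmul x (y ∷ z ∷ xs) (suc i) = cong ((if y <ᵇ x then 1 else 0) +_) (countLess-rmul x (z ∷ xs) i)

<ᵇ-true : ∀ {m n} → m < n → (m <ᵇ n) ≡ true
<ᵇ-true {zero}  {suc n} m<n       = refl
<ᵇ-true {suc m} {suc n} (s≤s m<n) = <ᵇ-true m<n

<ᵇ-false : ∀ {m n} → n ≤ m → (m <ᵇ n) ≡ false
<ᵇ-false {m}     {zero}  n≤m       = refl
<ᵇ-false {suc m} {suc n} (s≤s n≤m) = <ᵇ-false n≤m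

len-transposeHead : ∀ x y xs → x < y → len (y ∷ x ∷ xs) ≡ suc (len (x ∷ y ∷ xs))
len-transposeHead x y xs x<y rewrite <ᵇ-true x<y | <ᵇ-false (ℕₚ.<⇒≤ x<y) =
  cong suc (+-left-comm (countLess y xs) (countLess x xs) (len xs))

len-ascent : ∀ (g : ℕ → ℕ) n i → suc i < n → g i < g (suc i) → len (rmul (applyUpTo g n) i) ≡ suc (len (applyUpTo g n))
len-ascent g (suc zero)    zero    (s≤s ()) g<g
len-ascent g (suc (suc m)) zero    1+i<n       g<g = len-transposeHead (g 0) (g 1) (applyUpTo (g ∘ suc ∘ suc) m) g<g
len-ascent g (suc (suc m)) (suc i) (s≤s 1+i<n) g<g =
  trans (cong₂ _+_ (countLess-rmul (g 0) (applyUpTo (g ∘ suc) (suc m)) i) (len-ascent (g ∘ suc) (suc m) i 1+i<n g<g))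
        (ℕₚ.+-suc _ _)

len-descent : ∀ (g : ℕ → ℕ) n i → suc i < n → g (suc i) < g i → len (applyUpTo g n) ≡ suc (len (rmul (applyUpTo g n) i))
len-descent g (suc zero)    zero    (s≤s ()) g<g
len-descent g (suc (suc m)) zero    1+i<n       g<g = len-transposeHead (g 1) (g 0) (applyUpTo (g ∘ suc ∘ suc) m) g<g
len-descent g (suc (suc m)) (suc i) (s≤s 1+i<n) g<g =
  trans (cong₂ _+_ (sym (countLess-rmul (g 0) (applyUpTo (g ∘ suc) (suc m)) i)) (len-descent (g ∘ suc) (suc m) i 1+i<n g<g))
        (ℕₚ.+-suc _ _)

ascends-applyUpTo : ∀ (g : ℕ → ℕ) n i → suc i < n → g i < g (suc i) → ascends (applyUpTo g n) i ≡ true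
ascends-applyUpTo g n i 1+i<n g<g rewrite len-ascent g n i 1+i<n g<g = <ᵇ-true (ℕₚ.n<1+n (len (applyUpTo g n)))

descends-applyUpTo : ∀ (g : ℕ → ℕ) n i → suc i < n → g (suc i) < g i → ascends (applyUpTo g n) i ≡ false
descends-applyUpTo g n i 1+i<n g<g rewrite len-descent g n i 1+i<n g<g = <ᵇ-false (ℕₚ.n≤1+n (len (rmul (applyUpTo g n) i)))

-- For a set o of positions containing no two consecutive ones: the product of the commuting s_p, p ∈ o.
matching : (ℕ → Bool) → ℕ → ℕ
matching o zero    = if o zero then 1 else 0
matching o (suc p) = if o (suc p) then suc (suc p) else if o p then p else suc p

matching-open : ∀ o i → o i ≡ true → matching o i ≡ suc i
matching-open o zero    oi rewrite oi = refl
matching-open o (suc i) oi rewrite oi = refl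

matching-aboveOpen : ∀ o i → o i ≡ true → o (suc i) ≡ false → matching o (suc i) ≡ i
matching-aboveOpen o i oi o1+i rewrite o1+i | oi = refl

matching-closed-≤ : ∀ o i → o i ≡ false → matching o i ≤ i
matching-closed-≤ o zero    oi rewrite oi = z≤n
matching-closed-≤ o (suc i) o1+i rewrite o1+i with o i
... | true  = ℕₚ.n≤1+n i
... | false = ℕₚ.≤-refl

matching-aboveClosed-≥ : ∀ o i → o i ≡ false → suc i ≤ matching o (suc i)
matching-aboveClosed-≥ o i oi with o (suc i)
... | true  = ℕₚ.n≤1+n (suc i)
... | false rewrite oi = ℕₚ.≤-refl

matching-closedNeighbours : ∀ o p → o p ≡ false → (∀ j → suc j ≡ p → o j ≡ false) → matching o p ≡ p
matching-closedNeighbours o zero    op below rewrite op = refl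
matching-closedNeighbours o (suc j) op below rewrite op | below j refl = refl

matching-local : ∀ o o' p → o p ≡ o' p → (∀ j → suc j ≡ p → o j ≡ o' j) → matching o p ≡ matching o' p
matching-local o o' zero    op below rewrite op = refl
matching-local o o' (suc j) op below rewrite op | below j refl = refl

matching-cong : ∀ {o o'} → (∀ p → o p ≡ o' p) → ∀ p → matching o p ≡ matching o' p
matching-cong {o} {o'} o≗o' p = matching-local o o' p (o≗o' p) (λ j _ → o≗o' j)

matching-none : ∀ o → (∀ p → o p ≡ false) → ∀ p → matching o p ≡ p
matching-none o none p = matching-closedNeighbours o p (none p) (λ j _ → none j)

Isolated : (ℕ → Bool) → ℕ → Set
Isolated o i = o (suc i) ≡ false × (∀ j → suc j ≡ i → o j ≡ false)

AgreeOutside : ℕ → (ℕ → Bool) → (ℕ → Bool) → Set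
AgreeOutside i o o' = ∀ p → p ≢ i → o p ≡ o' p

isolated-transfer : ∀ {o o' i} → AgreeOutside i o o' → Isolated o i → Isolated o' i
isolated-transfer {i = i} agree (above , below) =
  trans (sym (agree (suc i) ℕₚ.1+n≢n)) above ,
  λ j 1+j≡i → trans (sym (agree j (λ j≡i → ℕₚ.1+n≢n (trans 1+j≡i (sym j≡i))))) (below j 1+j≡i)

matching-toggle : ∀ {o o' i} → AgreeOutside i o o' → Isolated o i → o i ≡ false → o' i ≡ true →
                  ∀ p → matching o (swap i p) ≡ matching o' p
matching-toggle {o} {o'} {i} agree iso@(above , below) oi o'i p with p ℕ.≟ i | p ℕ.≟ suc i
... | yes refl | _ = begin
  matching o (swap p p)  ≡⟨ cong (matching o) (swap-left p) ⟩
  matching o (suc p)     ≡⟨ matching-closedNeighbours o (suc p) above (λ { j refl → oi }) ⟩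
  suc p                  ≡⟨ matching-open o' p o'i ⟨
  matching o' p          ∎
  where open ≡-Reasoning
... | no _ | yes refl = begin
  matching o (swap i (suc i))  ≡⟨ cong (matching o) (swap-right i) ⟩
  matching o i                 ≡⟨ matching-closedNeighbours o i oi below ⟩
  i                            ≡⟨ matching-aboveOpen o' i o'i (proj₁ (isolated-transfer agree iso)) ⟨
  matching o' (suc i)          ∎
  where open ≡-Reasoning
... | no p≢i | no p≢1+i = trans (cong (matching o) (swap-fixed i p p≢i p≢1+i))
  (matching-local o o' p (agree p p≢i) (λ j 1+j≡p → agree j (λ j≡i → p≢1+i (trans (sym 1+j≡p) (cong suc j≡i)))))

matching-untoggle : ∀ {o o' i} → AgreeOutside i o o' → Isolated o i → o i ≡ true → o' i ≡ false →
                    ∀ p → matching o (swap i p) ≡ matching o' p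
matching-untoggle {o} {o'} {i} agree iso oi o'i p = sym (begin
  matching o' p                    ≡⟨ cong (matching o') (swap-involutive i p) ⟨
  matching o' (swap i (swap i p))  ≡⟨ matching-toggle agree′ (isolated-transfer agree iso) o'i oi (swap i p) ⟩
  matching o (swap i p)            ∎)
  where
  open ≡-Reasoning
  agree′ : AgreeOutside i o' o
  agree′ p p≢i = sym (agree p p≢i)

count-≢ : ∀ {c x} w → c ≢ x → count c (x ∷ w) ≡ count c w
count-≢ {c} {x} w c≢x with c ℕ.≟ x
... | yes c≡x = ⊥-elim (c≢x c≡x)
... | no  _   = refl

count-≡ : ∀ c w → count c (c ∷ w) ≡ suc (count c w)
count-≡ c w with c ℕ.≟ c
... | yes _   = refl
... | no  c≢c = ⊥-elim (c≢c refl)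

count≡0⇒≢ : ∀ {c x} w → count c (x ∷ w) ≡ 0 → c ≢ x
count≡0⇒≢ {c} w eq refl = ℕₚ.1+n≢0 (trans (sym (count-≡ c w)) eq)

count≡0-tail : ∀ {c x} w → count c (x ∷ w) ≡ 0 → count c w ≡ 0
count≡0-tail w eq = trans (sym (count-≢ w (count≡0⇒≢ w eq))) eq

count≡1-tail : ∀ {c x} w → c ≢ x → count c (x ∷ w) ≡ 1 → count c w ≡ 1
count≡1-tail w c≢x eq = trans (sym (count-≢ w c≢x)) eq

count≡1-head : ∀ {c} w → count c (c ∷ w) ≡ 1 → count c w ≡ 0
count≡1-head {c} w eq = ℕₚ.suc-injective (trans (sym (count-≡ c w)) eq)

count-++ : ∀ c a b → count c (a ++ b) ≡ count c a + count c b
count-++ c []      b = refl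
count-++ c (x ∷ a) b = trans (cong (hit +_) (count-++ c a b)) (sym (ℕₚ.+-assoc hit (count c a) (count c b)))
  where
  hit : ℕ
  hit = if ⌊ c ℕ.≟ x ⌋ then 1 else 0

count≡0-split : ∀ c a x b → count c (a ++ x ∷ b) ≡ 0 → count c a ≡ 0 × count c b ≡ 0
count≡0-split c a x b eq = ℕₚ.m+n≡0⇒m≡0 (count c a) eq′ , count≡0-tail b (ℕₚ.m+n≡0⇒n≡0 (count c a) eq′)
  where
  eq′ : count c a + count c (x ∷ b) ≡ 0
  eq′ = trans (sym (count-++ c a (x ∷ b))) eq

firstOccurrence : ∀ c X → count c X ≡ 0 ⊎ ∃[ X₁ ] ∃[ X₂ ] (X ≡ X₁ ++ c ∷ X₂ × count c X₁ ≡ 0)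
firstOccurrence c []      = inj₁ refl
firstOccurrence c (x ∷ X) with c ℕ.≟ x
... | yes refl = inj₂ ([] , X , refl , refl)
... | no c≢x with firstOccurrence c X
...   | inj₁ c∉X                     = inj₁ c∉X
...   | inj₂ (X₁ , X₂ , refl , c∉X₁) = inj₂ (x ∷ X₁ , X₂ , refl , trans (count-≢ X₁ c≢x) c∉X₁)

valid-letter : ∀ {n} c w → ValidWord n w → 0 < count c w → suc c < n
valid-letter c (x ∷ w) (1+x<n ∷ valid) occurs with c ℕ.≟ x
... | yes refl = 1+x<n
... | no  _    = valid-letter c w valid occurs

twoOccurrences : ∀ c l → count c l ≡ 2 → ∃[ A ] ∃[ X ] ∃[ B ] (l ≡ A ++ c ∷ X ++ c ∷ B × count c X ≡ 0)
twoOccurrences c l twice with firstOccurrence c l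
... | inj₁ c∉l = ⊥-elim (ℕₚ.1+n≢0 (trans (sym twice) c∉l))
... | inj₂ (A , R , refl , c∉A) with firstOccurrence c R
...   | inj₁ c∉R with () ← trans (sym (trans (count-++ c A (c ∷ R)) (cong₂ _+_ c∉A (trans (count-≡ c R) (cong suc c∉R))))) twice
...   | inj₂ (X , B , refl , c∉X) = A , X , B , refl , c∉X

data OccursBefore (j i : ℕ) : List ℕ → Set where
  here  : ∀ {w} → OccursBefore j i (j ∷ w)
  there : ∀ {x w} → x ≢ j → x ≢ i → OccursBefore j i w → OccursBefore j i (x ∷ w)

occursBefore-++ : ∀ j x X Y → count x X ≡ 0 → 0 < count j X → OccursBefore j x (X ++ x ∷ Y)
occursBefore-++ j x (y ∷ X) Y x∉ occurs with j ℕ.≟ y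
... | yes refl = here
... | no j≢y   = there (≢-sym j≢y) (≢-sym (count≡0⇒≢ X x∉)) (occursBefore-++ j x X Y (count≡0-tail X x∉) occurs)

-- no path from g along w, in the recursion defining pathSum, reaches the identity
data Dead (n : ℕ) : (ℕ → ℕ) → List ℕ → Set where
  end  : ∀ {g} p → p < n → g p ≢ p → Dead n g []
  step : ∀ {g i w} → Dead n (g ∘ swap i) w → Dead n g w → Dead n g (i ∷ w)

pathSum-dead : ∀ n g w → ValidWord n w → Dead n g w → ∀ k → pathSum n (applyUpTo g n) k w ≈P []
pathSum-dead n g [] _ (end p p<n gp≢p) k with List.≡-dec ℕ._≟_ (idP n) (applyUpTo g n)
... | yes id≡g = ⊥-elim (idP≢applyUpTo n g p p<n gp≢p id≡g)
... | no  _    = ≈P-refl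
pathSum-dead n g (i ∷ w) (1+i<n ∷ valid) (step take stay) k = addP-cong
  (subst (λ u → pathSum n u k w ≈P []) (sym (rmul-applyUpTo g n i 1+i<n)) (pathSum-dead n (g ∘ swap i) w valid take k))
  (if-[] (ascends (applyUpTo g n) i) (pathSum-dead n g w valid stay (suc k)))
  where
  if-[] : ∀ b {p} → p ≈P [] → (if b then p else []) ≈P []
  if-[] true  p≈[] = p≈[]
  if-[] false _    = ≈P-refl

record Carries (g : ℕ → ℕ) (P Q : ℕ → Set) : Set where
  constructor carries
  field
    position : ℕ
    source   : P position
    target   : Q (g position)

carries-swap : ∀ {P P' Q : ℕ → Set} g x → (∀ {p} → P p → P' (swap x p)) → Carries g P Q → Carries (g ∘ swap x) P' Q
carries-swap {Q = Q} g x f (carries p Pp Qgp) = carries (swap x p) (f Pp) (subst Q (cong g (sym (swap-involutive x p))) Qgp)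

carries-map : ∀ {P P' Q Q' : ℕ → Set} {g} → (∀ {p} → P p → P' p) → (∀ {v} → Q v → Q' v) → Carries g P Q → Carries g P' Q'
carries-map f h (carries p Pp Qgp) = carries p (f Pp) (h Qgp)

-- Only s_c moves values between the positions ≤ c and the positions > c.
dead-crossing : ∀ {n c g} w → c < n → count c w ≡ 0 → Carries g (_≤ c) (c <_) → Dead n g w
dead-crossing [] c<n _ (carries p p≤c c<gp) =
  end p (ℕₚ.≤-<-trans p≤c c<n) (λ gp≡p → ℕₚ.<⇒≱ c<gp (subst (_≤ _) (sym gp≡p) p≤c))
dead-crossing {c = c} {g} (x ∷ w) c<n c∉ C = step
  (dead-crossing w c<n (count≡0-tail w c∉) (carries-swap g x (swap-≤ x c _ (≢-sym (count≡0⇒≢ w c∉))) C))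
  (dead-crossing w c<n (count≡0-tail w c∉) C)

-- Only s_a and s_{a+1} move the position a + 1.
dead-misplaced : ∀ {n a g} w → ValidWord n w → count a w ≡ 0 → count (suc a) w ≡ 0 →
                 Carries g (λ q → q < n × q ≢ suc a) (_≡ suc a) → Dead n g w
dead-misplaced [] _ _ _ (carries q (q<n , q≢1+a) gq≡1+a) = end q q<n (λ gq≡q → q≢1+a (trans (sym gq≡q) gq≡1+a))
dead-misplaced {n} {a} {g} (x ∷ w) (1+x<n ∷ valid) a∉ 1+a∉ C = step
  (dead-misplaced w valid (count≡0-tail w a∉) (count≡0-tail w 1+a∉) (carries-swap g x keep C))
  (dead-misplaced w valid (count≡0-tail w a∉) (count≡0-tail w 1+a∉) C)
  where
  1+a-fixed : swap x (suc a) ≡ suc a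
  1+a-fixed = swap-fixed x (suc a) (count≡0⇒≢ w 1+a∉) (count≡0⇒≢ w a∉ ∘ ℕₚ.suc-injective)
  keep : ∀ {q} → q < n × q ≢ suc a → swap x q < n × swap x q ≢ suc a
  keep {q} (q<n , q≢1+a) = swap-< x n q 1+x<n q<n ,
    λ eq → q≢1+a (trans (sym (swap-involutive x q)) (trans (cong (swap x) eq) 1+a-fixed))

-- In the following configurations, at the occurrence of s_a or s_{a+1} that matters, multiplying leads to
-- dead-misplaced or to one of the earlier configurations, and staying leads to dead-crossing.
dead-onlyUpper : ∀ {n a g} w → ValidWord n w → count a w ≡ 0 → count (suc a) w ≡ 1 →
                 Carries g (_≤ suc a) (_≡ suc a) → Carries g (_≤ suc a) (suc a <_) → Dead n g w
dead-onlyUpper {n} {a} {g} (x ∷ w) (1+x<n ∷ valid) a∉ once C₁ C₂ with x ℕ.≟ suc a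
... | yes refl = step
  (dead-misplaced w valid (count≡0-tail w a∉) (count≡1-head w once) (carries-swap g x leave C₁))
  (dead-crossing w (ℕₚ.<-trans (ℕₚ.n<1+n x) 1+x<n) (count≡1-head w once) C₂)
  where
  leave : ∀ {p} → p ≤ x → swap x p < n × swap x p ≢ x
  leave {p} p≤x = swap-< x n p 1+x<n (ℕₚ.≤-<-trans p≤x (ℕₚ.<-trans (ℕₚ.n<1+n x) 1+x<n)) ,
    λ eq → ℕₚ.1+n≰n (subst (_≤ x) (swap-≡-left x p eq) p≤x)
... | no x≢1+a = step
  (dead-onlyUpper w valid (count≡0-tail w a∉) once′ (carries-swap g x keep C₁) (carries-swap g x keep C₂))
  (dead-onlyUpper w valid (count≡0-tail w a∉) once′ C₁ C₂)
  where
  once′ : count (suc a) w ≡ 1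
  once′ = count≡1-tail w (≢-sym x≢1+a) once
  keep : ∀ {p} → p ≤ suc a → swap x p ≤ suc a
  keep = swap-≤ x (suc a) _ x≢1+a

dead-lowerFirst : ∀ {n a g} w → ValidWord n w → OccursBefore a (suc a) w → count a w ≡ 1 → count (suc a) w ≡ 1 →
                  Carries g (_≤ a) (_≡ suc a) → Carries g (_≤ suc a) (suc a <_) → Dead n g w
dead-lowerFirst {n} {a} {g} (.a ∷ w) (1+a<n ∷ valid) here once₀ once₁ C₁ C₂ = step
  (dead-onlyUpper w valid (count≡1-head w once₀) (count≡1-tail w ℕₚ.1+n≢n once₁)
    (carries-swap g a (swap-≤-suc a a _) C₁) (carries-swap g a (swap-≤ a (suc a) _ (≢-sym ℕₚ.1+n≢n)) C₂))
  (dead-crossing w (ℕₚ.<-trans (ℕₚ.n<1+n a) 1+a<n) (count≡1-head w once₀)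
    (carries-map id (λ eq → subst (a <_) (sym eq) (ℕₚ.n<1+n a)) C₁))
dead-lowerFirst {n} {a} {g} (x ∷ w) (_ ∷ valid) (there x≢a x≢1+a before) once₀ once₁ C₁ C₂ = step
  (dead-lowerFirst w valid before once₀′ once₁′
    (carries-swap g x (swap-≤ x a _ x≢a) C₁) (carries-swap g x (swap-≤ x (suc a) _ x≢1+a) C₂))
  (dead-lowerFirst w valid before once₀′ once₁′ C₁ C₂)
  where
  once₀′ : count a w ≡ 1
  once₀′ = count≡1-tail w (≢-sym x≢a) once₀
  once₁′ : count (suc a) w ≡ 1
  once₁′ = count≡1-tail w (≢-sym x≢1+a) once₁

dead-onlyLower : ∀ {n a g} w → ValidWord n w → count a w ≡ 1 → count (suc a) w ≡ 0 →
                 Carries g (λ p → p < n × suc a ≤ p) (_≡ suc a) → Carries g (_≤ a) (a <_) → Dead n g w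
dead-onlyLower {n} {a} {g} (x ∷ w) (1+x<n ∷ valid) once 1+a∉ C₁ C₂ with x ℕ.≟ a
... | yes refl = step
  (dead-misplaced w valid (count≡1-head w once) (count≡0-tail w 1+a∉) (carries-swap g x leave C₁))
  (dead-crossing w (ℕₚ.<-trans (ℕₚ.n<1+n x) 1+x<n) (count≡1-head w once) C₂)
  where
  leave : ∀ {p} → p < n × suc x ≤ p → swap x p < n × swap x p ≢ suc x
  leave {p} (p<n , 1+x≤p) = swap-< x n p 1+x<n p<n ,
    λ eq → ℕₚ.1+n≰n (subst (suc x ≤_) (swap-≡-right x p eq) 1+x≤p)
... | no x≢a = step
  (dead-onlyLower w valid once′ (count≡0-tail w 1+a∉) (carries-swap g x keep C₁) (carries-swap g x (swap-≤ x a _ x≢a) C₂))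
  (dead-onlyLower w valid once′ (count≡0-tail w 1+a∉) C₁ C₂)
  where
  once′ : count a w ≡ 1
  once′ = count≡1-tail w (≢-sym x≢a) once
  keep : ∀ {p} → p < n × suc a ≤ p → swap x p < n × suc a ≤ swap x p
  keep {p} (p<n , 1+a≤p) = swap-< x n p 1+x<n p<n , swap-≥ x (suc a) p (x≢a ∘ ℕₚ.suc-injective) 1+a≤p

dead-upperFirst : ∀ {n a g} w → ValidWord n w → OccursBefore (suc a) a w → count a w ≡ 1 → count (suc a) w ≡ 1 →
                  Carries g (λ p → p < n × suc (suc a) ≤ p) (_≡ suc a) → Carries g (_≤ a) (suc a <_) → Dead n g w
dead-upperFirst {n} {a} {g} (.(suc a) ∷ w) (2+a<n ∷ valid) here once₀ once₁ C₁ C₂ = step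
  (dead-onlyLower w valid (count≡1-tail w (≢-sym ℕₚ.1+n≢n) once₀) (count≡1-head w once₁)
    (carries-swap g (suc a) lower C₁)
    (carries-swap g (suc a) (swap-≤ (suc a) a _ ℕₚ.1+n≢n) (carries-map id (ℕₚ.<-trans (ℕₚ.n<1+n a)) C₂)))
  (dead-crossing w (ℕₚ.<-trans (ℕₚ.n<1+n (suc a)) 2+a<n) (count≡1-head w once₁) (carries-map ℕₚ.m≤n⇒m≤1+n id C₂))
  where
  lower : ∀ {p} → p < n × suc (suc a) ≤ p → swap (suc a) p < n × suc a ≤ swap (suc a) p
  lower {p} (p<n , 2+a≤p) = swap-< (suc a) n p 2+a<n p<n , swap-≥-pred (suc a) (suc a) p 2+a≤p
dead-upperFirst {n} {a} {g} (x ∷ w) (1+x<n ∷ valid) (there x≢1+a x≢a before) once₀ once₁ C₁ C₂ = step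
  (dead-upperFirst w valid before once₀′ once₁′ (carries-swap g x keep C₁) (carries-swap g x (swap-≤ x a _ x≢a) C₂))
  (dead-upperFirst w valid before once₀′ once₁′ C₁ C₂)
  where
  once₀′ : count a w ≡ 1
  once₀′ = count≡1-tail w (≢-sym x≢a) once₀
  once₁′ : count (suc a) w ≡ 1
  once₁′ = count≡1-tail w (≢-sym x≢1+a) once₁
  keep : ∀ {p} → p < n × suc (suc a) ≤ p → swap x p < n × suc (suc a) ≤ swap x p
  keep {p} (p<n , 2+a≤p) = swap-< x n p 1+x<n p<n , swap-≥ x (suc (suc a)) p (x≢1+a ∘ ℕₚ.suc-injective) 2+a≤p

-- Reduced 321-avoiding words

act : List ℕ → ℕ → ℕ
act []      p = p
act (i ∷ w) p = swap i (act w p)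

act-++ : ∀ a b p → act (a ++ b) p ≡ act a (act b p)
act-++ []      b p = refl
act-++ (i ∷ a) b p = cong (swap i) (act-++ a b p)

foldl-rmul : ∀ n g w → ValidWord n w → foldl rmul (applyUpTo g n) w ≡ applyUpTo (g ∘ act w) n
foldl-rmul n g []      []              = refl
foldl-rmul n g (i ∷ w) (1+i<n ∷ valid) rewrite rmul-applyUpTo g n i 1+i<n = foldl-rmul n (g ∘ swap i) w valid

prodW-act : ∀ n A B → ValidWord n A → ValidWord n B → (∀ p → act A p ≡ act B p) → prodW n A ≡ prodW n B
prodW-act n A B validA validB A≗B = begin
  prodW n A                 ≡⟨ foldl-rmul n id A validA ⟩
  applyUpTo (act A) n       ≡⟨ applyUpTo-cong n (λ p _ → A≗B p) ⟩
  applyUpTo (act B) n       ≡⟨ foldl-rmul n id B validB ⟨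
  prodW n B                 ∎
  where open ≡-Reasoning

Commutes : ℕ → ℕ → Set
Commutes i x = suc x < i ⊎ suc i < x

Neighbours : ℕ → ℕ → Set
Neighbours i j = j ≡ suc i ⊎ i ≡ suc j

Near : ℕ → ℕ → Set
Near i p = p ≡ i ⊎ p ≡ suc i

near? : ∀ i p → Near i p ⊎ (p ≢ i × p ≢ suc i)
near? i p with p ℕ.≟ i | p ℕ.≟ suc i
... | yes p≡i | _          = inj₁ (inj₁ p≡i)
... | no _    | yes p≡1+i  = inj₁ (inj₂ p≡1+i)
... | no p≢i  | no p≢1+i   = inj₂ (p≢i , p≢1+i)

swap-near : ∀ {i p} → Near i p → Near i (swap i p)
swap-near {i} (inj₁ refl) = inj₂ (swap-left i)
swap-near {i} (inj₂ refl) = inj₁ (swap-right i)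

commutes-sym : ∀ {i x} → Commutes i x → Commutes x i
commutes-sym (inj₁ 1+x<i) = inj₂ 1+x<i
commutes-sym (inj₂ 1+i<x) = inj₁ 1+i<x

swap-far : ∀ {i x p} → Commutes i x → Near i p → swap x p ≡ p
swap-far {i} {x} {p} far near = swap-fixed x p (proj₁ (apart far near)) (proj₂ (apart far near))
  where
  apart : ∀ {p} → Commutes i x → Near i p → p ≢ x × p ≢ suc x
  apart (inj₁ 1+x<i) (inj₁ refl) = ℕₚ.>⇒≢ (ℕₚ.<-trans (ℕₚ.n<1+n x) 1+x<i) , ℕₚ.>⇒≢ 1+x<i
  apart (inj₁ 1+x<i) (inj₂ refl) =
    ℕₚ.>⇒≢ (ℕₚ.<-trans (ℕₚ.n<1+n x) (ℕₚ.<-trans 1+x<i (ℕₚ.n<1+n i))) , ℕₚ.>⇒≢ (ℕₚ.<-trans 1+x<i (ℕₚ.n<1+n i))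
  apart (inj₂ 1+i<x) (inj₁ refl) =
    ℕₚ.<⇒≢ (ℕₚ.<-trans (ℕₚ.n<1+n i) 1+i<x) , ℕₚ.<⇒≢ (ℕₚ.<-trans (ℕₚ.n<1+n i) (ℕₚ.<-trans 1+i<x (ℕₚ.n<1+n x)))
  apart (inj₂ 1+i<x) (inj₂ refl) = ℕₚ.<⇒≢ 1+i<x , ℕₚ.<⇒≢ (ℕₚ.<-trans 1+i<x (ℕₚ.n<1+n x))

swap-comm-near : ∀ {i x p} → Commutes i x → Near i p → swap i (swap x p) ≡ swap x (swap i p)
swap-comm-near far near = trans (cong (swap _) (swap-far far near)) (sym (swap-far far (swap-near near)))

neighbours-sym : ∀ {i j} → Neighbours i j → Neighbours j i
neighbours-sym (inj₁ j≡1+i) = inj₂ j≡1+i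
neighbours-sym (inj₂ i≡1+j) = inj₁ i≡1+j

swap-comm : ∀ i x → Commutes i x → ∀ p → swap i (swap x p) ≡ swap x (swap i p)
swap-comm i x far p with near? i p | near? x p
... | inj₁ nearᵢ | _          = swap-comm-near far nearᵢ
... | inj₂ _     | inj₁ nearₓ = sym (swap-comm-near (commutes-sym far) nearₓ)
... | inj₂ (p≢i , p≢1+i) | inj₂ (p≢x , p≢1+x) =
  trans (cong (swap i) (swap-fixed x p p≢x p≢1+x))
        (trans (swap-fixed i p p≢i p≢1+i) (sym (trans (cong (swap x) (swap-fixed i p p≢i p≢1+i)) (swap-fixed x p p≢x p≢1+x))))

act-comm : ∀ i X → All (Commutes i) X → ∀ p → swap i (act X p) ≡ act X (swap i p)
act-comm i []      []           p = refl
act-comm i (x ∷ X) (far ∷ fars) p = trans (swap-comm i x far (act X p)) (cong (swap x) (act-comm i X fars p))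

module _ {n v W} (reduced : ReducedExpr n v W) where

  private
    valid : ValidWord n W
    valid = proj₁ reduced

    reducedLength : ∀ w → ValidWord n w → prodW n w ≡ v → length W ≤ length w
    reducedLength = proj₂ (proj₂ reduced)

    prodW-same : ∀ {W'} → ValidWord n W' → (∀ p → act W p ≡ act W' p) → prodW n W' ≡ v
    prodW-same valid' W≗W' = trans (sym (prodW-act n W _ valid valid' W≗W')) (proj₁ (proj₂ reduced))

  reduced-rearranged : ∀ {W'} → W ↭ W' → (∀ p → act W p ≡ act W' p) → ReducedExpr n v W'
  reduced-rearranged {W'} W↭W' W≗W' = valid' , prodW-same valid' W≗W' ,
    λ w valid-w eq → subst (_≤ length w) (↭-length W↭W') (reducedLength w valid-w eq)
    where
    valid' : ValidWord n W'
    valid' = All-resp-↭ W↭W' valid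

  reduced-noCancellation : ∀ {i W'} → W ↭ i ∷ i ∷ W' → (∀ p → act W p ≡ act W' p) → ⊥
  reduced-noCancellation {W' = W'} W↭ W≗W' = ℕₚ.<⇒≱ (ℕₚ.≤-trans (ℕₚ.n≤1+n _) (ℕₚ.≤-reflexive (sym (↭-length W↭))))
    (reducedLength W' valid' (prodW-same valid' W≗W'))
    where
    valid' : ValidWord n W'
    valid' = All.tail (All.tail (All-resp-↭ W↭ valid))

noCommutingRepeat : ∀ {n v} pre i X suf → ReducedExpr n v (pre ++ i ∷ X ++ i ∷ suf) → All (Commutes i) X → ⊥
noCommutingRepeat pre i X suf reduced fars = reduced-noCancellation reduced rearrange cancel
  where
  rearrange : pre ++ i ∷ X ++ i ∷ suf ↭ i ∷ i ∷ pre ++ X ++ suf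
  rearrange = begin
    pre ++ i ∷ X ++ i ∷ suf     ↭⟨ ↭-shift i pre (X ++ i ∷ suf) ⟩
    i ∷ pre ++ X ++ i ∷ suf     ≡⟨ cong (i ∷_) (List.++-assoc pre X (i ∷ suf)) ⟨
    i ∷ (pre ++ X) ++ i ∷ suf   ↭⟨ ↭-prep i (↭-shift i (pre ++ X) suf) ⟩
    i ∷ i ∷ (pre ++ X) ++ suf   ≡⟨ cong (λ l → i ∷ i ∷ l) (List.++-assoc pre X suf) ⟩
    i ∷ i ∷ pre ++ X ++ suf     ∎
    where open PermutationReasoning
  cancel : ∀ p → act (pre ++ i ∷ X ++ i ∷ suf) p ≡ act (pre ++ X ++ suf) p
  cancel p = begin
    act (pre ++ i ∷ X ++ i ∷ suf) p                ≡⟨ act-++ pre (i ∷ X ++ i ∷ suf) p ⟩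
    act pre (swap i (act (X ++ i ∷ suf) p))        ≡⟨ cong (act pre ∘ swap i) (act-++ X (i ∷ suf) p) ⟩
    act pre (swap i (act X (swap i (act suf p))))  ≡⟨ cong (act pre) (act-comm i X fars (swap i (act suf p))) ⟩
    act pre (act X (swap i (swap i (act suf p))))  ≡⟨ cong (act pre ∘ act X) (swap-involutive i (act suf p)) ⟩
    act pre (act X (act suf p))                    ≡⟨ cong (act pre) (act-++ X suf p) ⟨
    act pre (act (X ++ suf) p)                     ≡⟨ act-++ pre (X ++ suf) p ⟨
    act (pre ++ X ++ suf) p                        ∎
    where open ≡-Reasoning

noHiddenBraid : ∀ {n v} pre i X₁ k X₂ suf → ReducedExpr n v (pre ++ i ∷ X₁ ++ k ∷ X₂ ++ i ∷ suf) → Avoids321 n v →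
                All (Commutes i) X₁ → All (Commutes i) X₂ → Neighbours i k → ⊥
noHiddenBraid pre i X₁ k X₂ suf reduced avoids fars₁ fars₂ nb =
  avoids W' (reduced-rearranged reduced rearrange moveOut) (pre ++ X₁ , X₂ ++ suf , i , k , refl , nb)
  where
  W' : List ℕ
  W' = (pre ++ X₁) ++ i ∷ k ∷ i ∷ X₂ ++ suf
  rearrange : pre ++ i ∷ X₁ ++ k ∷ X₂ ++ i ∷ suf ↭ W'
  rearrange = begin
    pre ++ i ∷ X₁ ++ k ∷ X₂ ++ i ∷ suf     ↭⟨ ↭-shift i pre (X₁ ++ k ∷ X₂ ++ i ∷ suf) ⟩
    i ∷ pre ++ X₁ ++ k ∷ X₂ ++ i ∷ suf     ≡⟨ cong (i ∷_) (List.++-assoc pre X₁ (k ∷ X₂ ++ i ∷ suf)) ⟨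
    i ∷ (pre ++ X₁) ++ k ∷ X₂ ++ i ∷ suf   ↭⟨ ↭-sym (↭-shift i (pre ++ X₁) (k ∷ X₂ ++ i ∷ suf)) ⟩
    (pre ++ X₁) ++ i ∷ k ∷ X₂ ++ i ∷ suf   ↭⟨ ++⁺ˡ (pre ++ X₁) (↭-prep i (↭-prep k (↭-shift i X₂ suf))) ⟩
    W'                                     ∎
    where open PermutationReasoning
  moveOut : ∀ p → act (pre ++ i ∷ X₁ ++ k ∷ X₂ ++ i ∷ suf) p ≡ act W' p
  moveOut p = begin
    act (pre ++ i ∷ X₁ ++ k ∷ X₂ ++ i ∷ suf) p
      ≡⟨ act-++ pre _ p ⟩
    act pre (swap i (act (X₁ ++ k ∷ X₂ ++ i ∷ suf) p))
      ≡⟨ cong (act pre ∘ swap i) (trans (act-++ X₁ _ p) (cong (act X₁ ∘ swap k) (act-++ X₂ (i ∷ suf) p))) ⟩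
    act pre (swap i (act X₁ (swap k (act X₂ (swap i (act suf p))))))
      ≡⟨ cong (act pre) (act-comm i X₁ fars₁ _) ⟩
    act pre (act X₁ (swap i (swap k (act X₂ (swap i (act suf p))))))
      ≡⟨ cong (λ q → act pre (act X₁ (swap i (swap k q)))) (act-comm i X₂ fars₂ (act suf p)) ⟨
    act pre (act X₁ (swap i (swap k (swap i (act X₂ (act suf p))))))
      ≡⟨ cong (λ q → act pre (act X₁ (swap i (swap k (swap i q))))) (act-++ X₂ suf p) ⟨
    act pre (act X₁ (act (i ∷ k ∷ i ∷ X₂ ++ suf) p))
      ≡⟨ act-++ pre X₁ _ ⟨
    act (pre ++ X₁) (act (i ∷ k ∷ i ∷ X₂ ++ suf) p)
      ≡⟨ act-++ (pre ++ X₁) (i ∷ k ∷ i ∷ X₂ ++ suf) p ⟨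
    act W' p ∎
    where open ≡-Reasoning

commutes-of-absent : ∀ i Y → count i Y ≡ 0 → count (suc i) Y ≡ 0 → (∀ i' → i ≡ suc i' → count i' Y ≡ 0) → All (Commutes i) Y
commutes-of-absent i []      _ _ _ = []
commutes-of-absent i (x ∷ Y) i∉ 1+i∉ pred∉ =
  commutes (≢-sym (count≡0⇒≢ Y i∉)) (≢-sym (count≡0⇒≢ Y 1+i∉)) (λ i' eq → ≢-sym (count≡0⇒≢ Y (pred∉ i' eq))) ∷
  commutes-of-absent i Y (count≡0-tail Y i∉) (count≡0-tail Y 1+i∉) (λ i' eq → count≡0-tail Y (pred∉ i' eq))
  where
  commutes : x ≢ i → x ≢ suc i → (∀ i' → i ≡ suc i' → x ≢ i') → Commutes i x
  commutes x≢i x≢1+i x≢i-1 with ℕₚ.<-cmp x i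
  ... | tri≈ _ x≡i _ = ⊥-elim (x≢i x≡i)
  ... | tri< x<i _ _ = inj₁ (ℕₚ.≤∧≢⇒< x<i (λ 1+x≡i → x≢i-1 x (sym 1+x≡i) refl))
  ... | tri> _ _ i<x = inj₂ (ℕₚ.≤∧≢⇒< i<x (λ 1+i≡x → x≢1+i (sym 1+i≡x)))

length-infix : ∀ (a : List ℕ) x b → length a < length (a ++ x ∷ b)
length-infix a x b rewrite List.length-++ a {x ∷ b} = ℕₚ.m<m+n (length a) (s≤s z≤n)

length-suffix : ∀ (a : List ℕ) x b → length b < length (a ++ x ∷ b)
length-suffix a x b rewrite List.length-++ a {x ∷ b} = ℕₚ.m≤n+m (suc (length b)) (length a)

NoGap : List ℕ → Set
NoGap W = ∀ {i j} → Neighbours i j → ∀ pre X suf → W ≡ pre ++ i ∷ X ++ i ∷ suf → count j X ≡ 0 → ⊥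

-- By induction on the length of X, first shrinking X until i does not occur in it. If the other neighbour k
-- of i does not occur in X, the two i's cancel; if it occurs once, moving the i's next to it exhibits a braid
-- i k i in a reduced word of v; if it occurs twice, i does not occur between the two k's.
module _ {n W} (reduced : ReducedExpr n (prodW n W) W) (avoids : Avoids321 n (prodW n W)) where

  private
    reducedAs : ∀ {W'} → W ≡ W' → ReducedExpr n (prodW n W) W'
    reducedAs eq = subst (ReducedExpr n (prodW n W)) eq reduced

  noGap-bounded : ∀ N {i j} → Neighbours i j → ∀ pre X suf → length X < N →
                  W ≡ pre ++ i ∷ X ++ i ∷ suf → count j X ≡ 0 → ⊥
  noGap-absent : ∀ N {i j} → Neighbours i j → ∀ pre X suf → length X ≤ N →
                 W ≡ pre ++ i ∷ X ++ i ∷ suf → count i X ≡ 0 → count j X ≡ 0 → ⊥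
  noGap-otherNeighbour : ∀ N {i j k} → Neighbours i k → ∀ pre X suf → length X ≤ N →
                         W ≡ pre ++ i ∷ X ++ i ∷ suf → count i X ≡ 0 → count j X ≡ 0 →
                         (∀ Y → count i Y ≡ 0 → count j Y ≡ 0 → count k Y ≡ 0 → All (Commutes i) Y) → ⊥

  noGap-bounded (suc N) {i} {j} nb pre X suf X<N eq j∉X with firstOccurrence i X
  ... | inj₁ i∉X = noGap-absent N nb pre X suf (ℕₚ.≤-pred X<N) eq i∉X j∉X
  ... | inj₂ (X₁ , X₂ , refl , _) =
    noGap-bounded N nb pre X₁ (X₂ ++ i ∷ suf) (ℕₚ.<-≤-trans (length-infix X₁ i X₂) (ℕₚ.≤-pred X<N))
      (trans eq (cong (λ l → pre ++ i ∷ l) (List.++-assoc X₁ (i ∷ X₂) (i ∷ suf))))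
      (proj₁ (count≡0-split j X₁ i X₂ j∉X))

  noGap-absent N {zero} (inj₁ refl) pre X suf _ eq i∉X j∉X =
    noCommutingRepeat pre 0 X suf (reducedAs eq) (commutes-of-absent 0 X i∉X j∉X (λ _ ()))
  noGap-absent N {suc i} (inj₁ refl) pre X suf X≤N eq i∉X j∉X =
    noGap-otherNeighbour N (inj₂ refl) pre X suf X≤N eq i∉X j∉X
      (λ Y i∉Y j∉Y k∉Y → commutes-of-absent (suc i) Y i∉Y j∉Y (λ { _ refl → k∉Y }))
  noGap-absent N {suc j} (inj₂ refl) pre X suf X≤N eq i∉X j∉X =
    noGap-otherNeighbour N (inj₁ refl) pre X suf X≤N eq i∉X j∉X
      (λ Y i∉Y j∉Y k∉Y → commutes-of-absent (suc j) Y i∉Y k∉Y (λ { _ refl → j∉Y }))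

  noGap-otherNeighbour N {i} {j} {k} nbk pre X suf X≤N eq i∉X j∉X fars with firstOccurrence k X
  ... | inj₁ k∉X = noCommutingRepeat pre i X suf (reducedAs eq) (fars X i∉X j∉X k∉X)
  ... | inj₂ (X₁ , R , refl , k∉X₁) with count≡0-split i X₁ k R i∉X | count≡0-split j X₁ k R j∉X | firstOccurrence k R
  ...   | i∉X₁ , i∉R | j∉X₁ , j∉R | inj₁ k∉R =
    noHiddenBraid pre i X₁ k R suf (reducedAs (trans eq (cong (λ l → pre ++ i ∷ l) (List.++-assoc X₁ (k ∷ R) (i ∷ suf)))))
      avoids (fars X₁ i∉X₁ j∉X₁ k∉X₁) (fars R i∉R j∉R k∉R) nbk
  ...   | _ , i∉R | _ | inj₂ (X₂ , X₃ , refl , _) =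
    noGap-bounded N (neighbours-sym nbk) (pre ++ i ∷ X₁) X₂ (X₃ ++ i ∷ suf)
      (ℕₚ.<-≤-trans (ℕₚ.<-trans (length-infix X₂ k X₃) (length-suffix X₁ k (X₂ ++ k ∷ X₃))) X≤N)
      (trans eq regroup) (proj₁ (count≡0-split i X₂ k X₃ i∉R))
    where
    regroup : pre ++ i ∷ (X₁ ++ k ∷ X₂ ++ k ∷ X₃) ++ i ∷ suf ≡ (pre ++ i ∷ X₁) ++ k ∷ X₂ ++ k ∷ X₃ ++ i ∷ suf
    regroup = begin
      pre ++ i ∷ (X₁ ++ k ∷ X₂ ++ k ∷ X₃) ++ i ∷ suf
        ≡⟨ cong (λ l → pre ++ i ∷ l) (List.++-assoc X₁ (k ∷ X₂ ++ k ∷ X₃) (i ∷ suf)) ⟩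
      pre ++ i ∷ X₁ ++ k ∷ (X₂ ++ k ∷ X₃) ++ i ∷ suf
        ≡⟨ cong (λ l → pre ++ i ∷ X₁ ++ k ∷ l) (List.++-assoc X₂ (k ∷ X₃) (i ∷ suf)) ⟩
      pre ++ i ∷ X₁ ++ k ∷ X₂ ++ k ∷ X₃ ++ i ∷ suf
        ≡⟨ List.++-assoc pre (i ∷ X₁) (k ∷ X₂ ++ k ∷ X₃ ++ i ∷ suf) ⟨
      (pre ++ i ∷ X₁) ++ k ∷ X₂ ++ k ∷ X₃ ++ i ∷ suf  ∎
      where open ≡-Reasoning

  noGap : NoGap W
  noGap nb pre X suf eq j∉X = noGap-bounded (suc (length X)) nb pre X suf ℕₚ.≤-refl eq j∉X

-- Sums over sets of pairwise non-adjacent letters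

data Status : Set where
  chosen : Status
  weight : ℕ → Status
  free   : Status

-- Σ over the sets S of free positions such that S ∪ {chosen positions} contains no two consecutive positions,
-- of t^(k + Σ weights + 2 · #(free positions ∖ S)); the flag says whether the previous position is in that union.
statusPoly : Bool → List Status → ℕ → Poly
statusPoly p []                k = monoP k
statusPoly p (chosen   ∷ rest) k = if p then [] else statusPoly true rest k
statusPoly p (weight j ∷ rest) k = statusPoly false rest (j + k)
statusPoly p (free     ∷ rest) k = addP (statusPoly false rest (2 + k)) (if p then [] else statusPoly true rest k)

unlessChosen-cong : ∀ (p : Bool) {q r} → q ≈P r → (if p then [] else q) ≈P (if p then [] else r)
unlessChosen-cong true  _   = ≈P-refl
unlessChosen-cong false q≈r = q≈r

unlessChosen-[] : ∀ (p : Bool) {q} → q ≈P [] → (if p then [] else q) ≈P []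
unlessChosen-[] true  _    = ≈P-refl
unlessChosen-[] false q≈[] = q≈[]

unlessChosen-addP : ∀ (p : Bool) q r → (if p then [] else addP q r) ≈P addP (if p then [] else q) (if p then [] else r)
unlessChosen-addP true  q r = ≈P-refl
unlessChosen-addP false q r = ≈P-refl

statusPoly-suc : ∀ p ys k → statusPoly p ys (suc k) ≈P shift (statusPoly p ys k)
statusPoly-suc p     []                k = ≈P-refl
statusPoly-suc true  (chosen   ∷ ys)   k = ≈P-sym shift-[]
statusPoly-suc false (chosen   ∷ ys)   k = statusPoly-suc true ys k
statusPoly-suc p     (weight j ∷ ys)   k rewrite ℕₚ.+-suc j k = statusPoly-suc false ys (j + k)
statusPoly-suc true  (free     ∷ ys)   k = ≈P-trans (addP-cong (statusPoly-suc false ys (2 + k)) (≈P-sym shift-[]))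
                                                    (≈P-sym (shift-addP (statusPoly false ys (2 + k)) []))
statusPoly-suc false (free     ∷ ys)   k = ≈P-trans (addP-cong (statusPoly-suc false ys (2 + k)) (statusPoly-suc true ys k))
                                                    (≈P-sym (shift-addP (statusPoly false ys (2 + k)) (statusPoly true ys k)))

statusPoly-+ : ∀ p ys j k → statusPoly p ys (j + k) ≈P shiftBy j (statusPoly p ys k)
statusPoly-+ p ys zero    k = ≈P-refl
statusPoly-+ p ys (suc j) k = ≈P-trans (statusPoly-suc p ys (j + k)) (shift-cong (statusPoly-+ p ys j k))

statusPoly-weight-suc : ∀ pre post j p k → statusPoly p (pre ++ weight (suc j) ∷ post) k ≡ statusPoly p (pre ++ weight j ∷ post) (suc k)
statusPoly-weight-suc []                post j p     k = cong (statusPoly false post) (sym (ℕₚ.+-suc j k))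
statusPoly-weight-suc (chosen   ∷ pre) post j true  k = refl
statusPoly-weight-suc (chosen   ∷ pre) post j false k = statusPoly-weight-suc pre post j true k
statusPoly-weight-suc (weight i ∷ pre) post j p     k =
  trans (statusPoly-weight-suc pre post j false (i + k)) (cong (statusPoly false (pre ++ weight j ∷ post)) (sym (ℕₚ.+-suc i k)))
statusPoly-weight-suc (free     ∷ pre) post j p     k =
  cong₂ addP (statusPoly-weight-suc pre post j false (2 + k)) (cong (if p then [] else_) (statusPoly-weight-suc pre post j true k))

-- The t² of an unchosen free position is split into a factor t now and a letter of weight 1 left.
statusPoly-free : ∀ pre post p k →
  statusPoly p (pre ++ free ∷ post) k ≈P addP (statusPoly p (pre ++ chosen ∷ post) k) (statusPoly p (pre ++ weight 1 ∷ post) (suc k))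
statusPoly-free []                post p     k = addP-comm (statusPoly false post (2 + k)) (if p then [] else statusPoly true post k)
statusPoly-free (chosen   ∷ pre) post true  k = ≈P-refl
statusPoly-free (chosen   ∷ pre) post false k = statusPoly-free pre post true k
statusPoly-free (weight j ∷ pre) post p     k rewrite ℕₚ.+-suc j k = statusPoly-free pre post false (j + k)
statusPoly-free (free     ∷ pre) post p     k = ≈P-trans
  (addP-cong (statusPoly-free pre post false (2 + k))
             (≈P-trans (unlessChosen-cong p (statusPoly-free pre post true k)) (unlessChosen-addP p C₁ W₁)))
  (addP-interchange C₂ W₂ (if p then [] else C₁) (if p then [] else W₁))
  where
  C₁ W₁ C₂ W₂ : Poly
  C₁ = statusPoly true  (pre ++ chosen ∷ post) k
  W₁ = statusPoly true  (pre ++ weight 1 ∷ post) (suc k)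
  C₂ = statusPoly false (pre ++ chosen ∷ post) (2 + k)
  W₂ = statusPoly false (pre ++ weight 1 ∷ post) (suc (2 + k))

statusPoly-vanishes-∷ : ∀ {rest} → (∀ p k → statusPoly p rest k ≈P []) → ∀ s p k → statusPoly p (s ∷ rest) k ≈P []
statusPoly-vanishes-∷ rest≈[] chosen     true  k = ≈P-refl
statusPoly-vanishes-∷ rest≈[] chosen     false k = rest≈[] true k
statusPoly-vanishes-∷ rest≈[] (weight j) p     k = rest≈[] false (j + k)
statusPoly-vanishes-∷ rest≈[] free       p     k = addP-cong (rest≈[] false (2 + k)) (unlessChosen-[] p (rest≈[] true k))

statusPoly-adjacentChosen : ∀ (h : ℕ → Status) m a → suc a < m → h a ≡ chosen → h (suc a) ≡ chosen →
                            ∀ p k → statusPoly p (applyUpTo h m) k ≈P []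
statusPoly-adjacentChosen h (suc (suc m)) zero    _         h0 h1 p k rewrite h0 | h1 = vanish p
  where
  vanish : ∀ p → statusPoly p (chosen ∷ chosen ∷ applyUpTo (h ∘ suc ∘ suc) m) k ≈P []
  vanish true  = ≈P-refl
  vanish false = ≈P-refl
statusPoly-adjacentChosen h (suc m)       (suc a) (s≤s a<m) ha h1+a p k =
  statusPoly-vanishes-∷ (statusPoly-adjacentChosen (h ∘ suc) m a a<m ha h1+a) (h 0) p k

fibP-rec : ∀ m → fibP (suc (suc m)) ≈P addP (shift (fibP (suc m))) (fibP m)
fibP-rec m = addP-cong (mulP-monoP 1 (fibP (suc m))) ≈P-refl

shiftBy-fibP : ∀ k → shiftBy (suc k) (fibP (suc k)) ≈P shiftBy 2 (modFibP k)
shiftBy-fibP zero    = ≈P-refl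
shiftBy-fibP (suc k) = ≈P-trans (≡⇒≈P (sym (shiftBy-+ 2 k (fibP (2 + k))))) (shiftBy-cong 2 (≈P-sym (mulP-monoP k (fibP (2 + k)))))

modFibP-rec : ∀ k → modFibP (suc (suc k)) ≈P addP (shiftBy 2 (modFibP (suc k))) (shiftBy 2 (modFibP k))
modFibP-rec k = begin
  modFibP (2 + k)
    ≈⟨ mulP-monoP (suc k) (fibP (3 + k)) ⟩
  shiftBy (1 + k) (fibP (3 + k))
    ≈⟨ shiftBy-cong (1 + k) (fibP-rec (suc k)) ⟩
  shiftBy (1 + k) (addP (shift (fibP (2 + k))) (fibP (1 + k)))
    ≈⟨ shiftBy-addP (1 + k) (shift (fibP (2 + k))) (fibP (1 + k)) ⟩
  addP (shiftBy (1 + k) (shiftBy 1 (fibP (2 + k)))) (shiftBy (1 + k) (fibP (1 + k)))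
    ≡⟨ cong (λ s → addP s (shiftBy (1 + k) (fibP (1 + k)))) shifts ⟩
  addP (shiftBy (2 + k) (fibP (2 + k))) (shiftBy (1 + k) (fibP (1 + k)))
    ≈⟨ addP-cong (shiftBy-fibP (suc k)) (shiftBy-fibP k) ⟩
  addP (shiftBy 2 (modFibP (1 + k))) (shiftBy 2 (modFibP k)) ∎
  where
  open ≈P-Reasoning
  shifts : shiftBy (1 + k) (shiftBy 1 (fibP (2 + k))) ≡ shiftBy (2 + k) (fibP (2 + k))
  shifts = trans (shiftBy-+ (1 + k) 1 (fibP (2 + k))) (cong (λ j → shiftBy j (fibP (2 + k))) (ℕₚ.+-comm (1 + k) 1))

statusPoly-freeRun : ∀ rest → (∀ k → statusPoly true rest k ≡ statusPoly false rest k) →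
                     ∀ m k → statusPoly false (replicate m free ++ rest) k ≈P mulP (modFibP m) (statusPoly false rest k)
statusPoly-freeRun rest neutral zero          k = ≈P-sym (mulP-identityˡ _)
statusPoly-freeRun rest neutral (suc zero)    k = begin
  addP (statusPoly false rest (2 + k)) (statusPoly true rest k)
    ≈⟨ addP-cong (statusPoly-+ false rest 2 k) (≡⇒≈P (neutral k)) ⟩
  addP (shiftBy 2 R) R
    ≈⟨ addP-cong (≈P-trans (mulP-shiftByˡ 2 (monoP 0) R) (shiftBy-cong 2 (mulP-identityˡ R))) (mulP-identityˡ R) ⟨
  addP (mulP (shiftBy 2 (monoP 0)) R) (mulP (monoP 0) R)
    ≈⟨ mulP-distribʳ (shiftBy 2 (monoP 0)) (monoP 0) R ⟨
  mulP (modFibP 1) R ∎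
  where
  open ≈P-Reasoning
  R : Poly
  R = statusPoly false rest k
statusPoly-freeRun rest neutral (suc (suc m)) k = begin
  addP (statusPoly false (free ∷ Y) (2 + k)) (addP (statusPoly false Y (2 + k)) [])
    ≈⟨ addP-cong (statusPoly-+ false (free ∷ Y) 2 k) (≈P-trans (addP-identityʳ _) (statusPoly-+ false Y 2 k)) ⟩
  addP (shiftBy 2 (statusPoly false (free ∷ Y) k)) (shiftBy 2 (statusPoly false Y k))
    ≈⟨ addP-cong (shiftBy-cong 2 (statusPoly-freeRun rest neutral (suc m) k)) (shiftBy-cong 2 (statusPoly-freeRun rest neutral m k)) ⟩
  addP (shiftBy 2 (mulP (modFibP (suc m)) R)) (shiftBy 2 (mulP (modFibP m) R))
    ≈⟨ addP-cong (mulP-shiftByˡ 2 (modFibP (suc m)) R) (mulP-shiftByˡ 2 (modFibP m) R) ⟨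
  addP (mulP (shiftBy 2 (modFibP (suc m))) R) (mulP (shiftBy 2 (modFibP m)) R)
    ≈⟨ mulP-distribʳ (shiftBy 2 (modFibP (suc m))) (shiftBy 2 (modFibP m)) R ⟨
  mulP (addP (shiftBy 2 (modFibP (suc m))) (shiftBy 2 (modFibP m))) R
    ≈⟨ mulP-congˡ R (modFibP-rec m) ⟨
  mulP (modFibP (suc (suc m))) R ∎
  where
  open ≈P-Reasoning
  Y : List Status
  Y = replicate m free ++ rest
  R : Poly
  R = statusPoly false rest k

-- the status of an unchosen letter with c occurrences ahead; c ≥ 3 never happens
statusOf : ℕ → Status
statusOf zero                = weight 0
statusOf (suc zero)          = weight 1
statusOf (suc (suc zero))    = free
statusOf (suc (suc (suc _))) = weight 0

onesCount : List ℕ → ℕ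
onesCount cs = length (filter (λ c → c ℕ.≟ 1) cs)

chainProduct : List ℕ → Poly
chainProduct = foldr (λ λi acc → mulP (modFibP λi) acc) (monoP 0)

chainProduct-flush : ∀ m L → mulP (modFibP m) (chainProduct L) ≈P chainProduct (flush m L)
chainProduct-flush zero    L = mulP-identityˡ (chainProduct L)
chainProduct-flush (suc m) L = ≈P-refl

replicate-++-∷ : ∀ {A : Set} m (x : A) ys → replicate m x ++ x ∷ ys ≡ replicate (suc m) x ++ ys
replicate-++-∷ zero    x ys = refl
replicate-++-∷ (suc m) x ys = cong (x ∷_) (replicate-++-∷ m x ys)

statusPoly-endOfChain : ∀ m j cs → statusPoly false (map statusOf cs) 0 ≈P shiftBy (onesCount cs) (chainProduct (chainLens 0 cs)) →
  statusPoly false (replicate m free ++ weight j ∷ map statusOf cs) 0 ≈P shiftBy (j + onesCount cs) (chainProduct (flush m (chainLens 0 cs)))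
statusPoly-endOfChain m j cs rest≈ = begin
  statusPoly false (replicate m free ++ weight j ∷ M) 0
    ≈⟨ statusPoly-freeRun (weight j ∷ M) (λ _ → refl) m 0 ⟩
  mulP F (statusPoly false M (j + 0))
    ≈⟨ mulP-congʳ F (≈P-trans (statusPoly-+ false M j 0) (shiftBy-cong j rest≈)) ⟩
  mulP F (shiftBy j (shiftBy o Π))
    ≈⟨ ≈P-trans (mulP-shiftByʳ F j (shiftBy o Π)) (shiftBy-cong j (mulP-shiftByʳ F o Π)) ⟩
  shiftBy j (shiftBy o (mulP F Π))
    ≡⟨ shiftBy-+ j o (mulP F Π) ⟩
  shiftBy (j + o) (mulP F Π)
    ≈⟨ shiftBy-cong (j + o) (chainProduct-flush m (chainLens 0 cs)) ⟩
  shiftBy (j + o) (chainProduct (flush m (chainLens 0 cs))) ∎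
  where
  open ≈P-Reasoning
  M : List Status
  M = map statusOf cs
  F Π : Poly
  F = modFibP m
  Π = chainProduct (chainLens 0 cs)
  o : ℕ
  o = onesCount cs

statusPoly-counts : ∀ cs m → statusPoly false (replicate m free ++ map statusOf cs) 0 ≈P shiftBy (onesCount cs) (chainProduct (chainLens m cs))
statusPoly-counts []                        m = ≈P-trans (statusPoly-freeRun [] (λ _ → refl) m 0) (chainProduct-flush m [])
statusPoly-counts (zero ∷ cs)               m = statusPoly-endOfChain m 0 cs (statusPoly-counts cs 0)
statusPoly-counts (suc zero ∷ cs)           m = statusPoly-endOfChain m 1 cs (statusPoly-counts cs 0)
statusPoly-counts (suc (suc zero) ∷ cs)     m rewrite replicate-++-∷ m free (map statusOf cs) = statusPoly-counts cs (suc m)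
statusPoly-counts (suc (suc (suc _)) ∷ cs)  m = statusPoly-endOfChain m 0 cs (statusPoly-counts cs 0)

-- Reading the word

<-∸1 : ∀ {a n} → suc a < n → a < n ∸ 1
<-∸1 {n = suc n} (s≤s a<n) = a<n

statusAt : Bool → ℕ → Status
statusAt chosenBefore c = if chosenBefore then chosen else statusOf c

statusPoly-settled : ∀ m (T : ℕ → Bool) p k → (∀ i → T i ≡ true → T (suc i) ≡ false) → (p ≡ true → T 0 ≡ false) →
  statusPoly p (applyUpTo (λ i → statusAt (T i) 0) m) k ≡ monoP k
statusPoly-settled zero    T p k apart first = refl
statusPoly-settled (suc m) T p k apart first with T 0 in T0
... | false = statusPoly-settled m (T ∘ suc) false k (apart ∘ suc) (λ ())
... | true with p
...   | true  with () ← first refl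
...   | false = statusPoly-settled m (T ∘ suc) true k (apart ∘ suc) (λ _ → apart 0 T0)

pathSum-idP-[] : ∀ n k → pathSum n (idP n) k [] ≡ monoP k
pathSum-idP-[] n k with List.≡-dec ℕ._≟_ (idP n) (idP n)
... | yes _   = refl
... | no id≢id = ⊥-elim (id≢id refl)

choose : ℕ → (ℕ → Bool) → ℕ → Bool
choose x T p = if ⌊ p ℕ.≟ x ⌋ then true else T p

choose-≡ : ∀ x T → choose x T x ≡ true
choose-≡ x T with x ℕ.≟ x
... | yes _   = refl
... | no x≢x  = ⊥-elim (x≢x refl)

choose-≢ : ∀ {x p} T → p ≢ x → choose x T p ≡ T p
choose-≢ {x} {p} T p≢x with p ℕ.≟ x
... | yes p≡x = ⊥-elim (p≢x p≡x)
... | no  _   = refl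

chosenBelow? : ∀ (T : ℕ → Bool) x → (∀ j → suc j ≡ x → T j ≡ false) ⊎ ∃[ a ] (suc a ≡ x × T a ≡ true)
chosenBelow? T zero    = inj₁ (λ _ ())
chosenBelow? T (suc a) with T a in Ta
... | true  = inj₂ (a , refl , Ta)
... | false = inj₁ (λ { _ refl → Ta })

module Scanning (n : ℕ) (W : List ℕ) (valid : ValidWord n W) (atMostTwice : ∀ i → count i W ≤ 2) (noGap : NoGap W) where

  -- chosen letters whose second occurrence is still ahead: the current permutation is their matching
  pending : (ℕ → Bool) → List ℕ → ℕ → Bool
  pending T w p = T p ∧ ⌊ count p w ℕ.≟ 1 ⌋

  statuses : (ℕ → Bool) → List ℕ → List Status
  statuses T w = applyUpTo (λ i → statusAt (T i) (count i w)) (n ∸ 1)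

  -- T: the letters whose first occurrence the path multiplied by, having read done
  record Invariant (T : ℕ → Bool) (done w : List ℕ) : Set where
    field
      split          : W ≡ done ++ w
      valid-rest     : ValidWord n w
      chosen-twice   : ∀ i → T i ≡ true → count i W ≡ 2
      chosen-pending : ∀ i → T i ≡ true → count i w ≤ 1
      chosen-apart   : ∀ i → T i ≡ true → T (suc i) ≡ false

  Scanned : (ℕ → Bool) → List ℕ → ℕ → Set
  Scanned T w k = pathSum n (applyUpTo (matching (pending T w)) n) k w ≈P statusPoly false (statuses T w) k

  pending-unchosen : ∀ T w p → T p ≡ false → pending T w p ≡ false
  pending-unchosen T w p Tp rewrite Tp = refl

  pending-absent : ∀ T w {p} → count p w ≡ 0 → pending T w p ≡ false
  pending-absent T w {p} p∉w rewrite p∉w with T p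
  ... | true  = refl
  ... | false = refl

  pending-once : ∀ T w p → T p ≡ true → count p w ≡ 1 → pending T w p ≡ true
  pending-once T w p Tp once rewrite Tp | once = refl

  pending-∷ : ∀ T w {x p} → p ≢ x → pending T (x ∷ w) p ≡ pending T w p
  pending-∷ T w p≢x rewrite count-≢ w p≢x = refl

  scanned-[] : ∀ T done → Invariant T done [] → ∀ k → Scanned T [] k
  scanned-[] T done inv k = ≈P-trans (≡⇒≈P (trans (cong (λ u → pathSum n u k []) noneOpen) (pathSum-idP-[] n k)))
    (≡⇒≈P (sym (statusPoly-settled (n ∸ 1) T false k (Invariant.chosen-apart inv) (λ ()))))
    where
    noneOpen : applyUpTo (matching (pending T [])) n ≡ idP n
    noneOpen = applyUpTo-cong n (λ p _ → matching-none (pending T []) (λ q → pending-absent T [] refl) p)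

  module Step (x : ℕ) (w done : List ℕ) (T : ℕ → Bool) (inv : Invariant T done (x ∷ w))
              (ih : ∀ T' → Invariant T' (done ++ x ∷ []) w → ∀ k → Scanned T' w k) where
    open Invariant inv

    1+x<n : suc x < n
    1+x<n = All.head valid-rest

    o : ℕ → Bool
    o = pending T (x ∷ w)

    g : ℕ → ℕ
    g = matching o

    u : Perm
    u = applyUpTo g n

    count-W : count x W ≡ count x done + suc (count x w)
    count-W = trans (cong (count x) split) (trans (count-++ x done (x ∷ w)) (cong (count x done +_) (count-≡ x w)))

    count-done : count x w ≡ 1 → count x done ≡ 0
    count-done once = ℕₚ.n≤0⇒n≡0 (ℕₚ.+-cancelʳ-≤ 2 (count x done) 0
      (subst (_≤ 2) (trans count-W (cong (λ c → count x done + suc c) once)) (atMostTwice x)))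

    atMostOnceAhead : count x w ≤ 1
    atMostOnceAhead = ℕₚ.≤-pred (ℕₚ.≤-trans (ℕₚ.m≤n+m (suc (count x w)) (count x done)) (subst (_≤ 2) count-W (atMostTwice x)))

    keep : Invariant T (done ++ x ∷ []) w
    keep = record
      { split          = trans split (sym (List.++-assoc done (x ∷ []) w))
      ; valid-rest     = All.tail valid-rest
      ; chosen-twice   = chosen-twice
      ; chosen-pending = λ i Ti → ℕₚ.≤-trans (ℕₚ.m≤n+m (count i w) _) (chosen-pending i Ti)
      ; chosen-apart   = chosen-apart
      }

    h : ℕ → Status
    h i = statusAt (T i) (count i (x ∷ w))

    pre post : List Status
    pre  = applyUpTo h x
    post = applyUpTo (h ∘ (suc x +_)) (n ∸ 1 ∸ suc x)

    x<m : x < n ∸ 1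
    x<m = <-∸1 1+x<n

    statuses-at : ∀ T' w' → (∀ q → q ≢ x → T' q ≡ T q) → (∀ q → q ≢ x → count q w' ≡ count q (x ∷ w)) →
                  statuses T' w' ≡ pre ++ statusAt (T' x) (count x w') ∷ post
    statuses-at T' w' sameT sameCount =
      applyUpTo-update h _ (n ∸ 1) x x<m (λ q q≢x → cong₂ statusAt (sameT q q≢x) (sameCount q q≢x))

    statuses-here : ∀ {s} → h x ≡ s → statuses T (x ∷ w) ≡ pre ++ s ∷ post
    statuses-here eq = trans (applyUpTo-splitAt h (n ∸ 1) x x<m) (cong (λ s → pre ++ s ∷ post) eq)

    statuses-rest : ∀ {s} → statusAt (T x) (count x w) ≡ s → statuses T w ≡ pre ++ s ∷ post
    statuses-rest eq = trans (statuses-at T w (λ _ _ → refl) (λ q q≢x → sym (count-≢ w q≢x))) (cong (λ s → pre ++ s ∷ post) eq)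

    statuses-chosen : statuses (choose x T) (x ∷ w) ≡ pre ++ chosen ∷ post
    statuses-chosen = trans (statuses-at (choose x T) (x ∷ w) (λ q q≢x → choose-≢ T q≢x) (λ _ _ → refl))
                            (cong (λ b → pre ++ statusAt b (count x (x ∷ w)) ∷ post) (choose-≡ x T))

    chosen-below : T x ≡ true → ∀ j → suc j ≡ x → T j ≡ false
    chosen-below Tx j 1+j≡x with T j in Tj
    ... | false = refl
    ... | true with () ← trans (sym Tx) (subst (λ y → T y ≡ false) 1+j≡x (chosen-apart j Tj))

    ascent : T x ≡ false → ascends u x ≡ true
    ascent Tx = ascends-applyUpTo g n x 1+x<n
      (ℕₚ.≤-trans (s≤s (matching-closed-≤ o x ox)) (matching-aboveClosed-≥ o x ox))
      where ox = pending-unchosen T (x ∷ w) x Tx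

    stay : T x ≡ false → ∀ k → pathSum n u (suc k) w ≈P statusPoly false (statuses T w) (suc k)
    stay Tx k = ≈P-trans (≡⇒≈P (cong (λ v → pathSum n v (suc k) w) unchanged)) (ih T keep (suc k))
      where
      samePending : ∀ p → o p ≡ pending T w p
      samePending p = byCase (p ℕ.≟ x)
        where
        byCase : Dec (p ≡ x) → o p ≡ pending T w p
        byCase (yes refl) = trans (pending-unchosen T (x ∷ w) x Tx) (sym (pending-unchosen T w x Tx))
        byCase (no p≢x)   = pending-∷ T w p≢x
      unchanged : u ≡ applyUpTo (matching (pending T w)) n
      unchanged = applyUpTo-cong n (λ p _ → matching-cong samePending p)

    take-dead : Dead n (g ∘ swap x) w → ∀ k → pathSum n (rmul u x) k w ≈P []
    take-dead dead k = subst (λ v → pathSum n v k w ≈P []) (sym (rmul-applyUpTo g n x 1+x<n))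
                             (pathSum-dead n (g ∘ swap x) w (All.tail valid-rest) dead k)

    closedNeighbour : ∀ j → Neighbours j x → T j ≡ true → count j (x ∷ w) ≡ 0 → count x w ≡ 1 → ⊥
    closedNeighbour j nb Tj j∉ once with twoOccurrences j done twiceBefore
      where
      twiceBefore : count j done ≡ 2
      twiceBefore = begin
        count j done                       ≡⟨ ℕₚ.+-identityʳ _ ⟨
        count j done + 0                   ≡⟨ cong (count j done +_) j∉ ⟨
        count j done + count j (x ∷ w)     ≡⟨ count-++ j done (x ∷ w) ⟨
        count j (done ++ x ∷ w)            ≡⟨ cong (count j) split ⟨
        count j W                          ≡⟨ chosen-twice j Tj ⟩
        2                                  ∎
        where open ≡-Reasoning
    ... | A , X , B , done≡ , _ = noGap nb A X (B ++ x ∷ w) W≡ x∉X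
      where
      W≡ : W ≡ A ++ j ∷ X ++ j ∷ B ++ x ∷ w
      W≡ = trans split (trans (cong (_++ x ∷ w) done≡)
             (trans (List.++-assoc A (j ∷ X ++ j ∷ B) (x ∷ w)) (cong (λ l → A ++ j ∷ l) (List.++-assoc X (j ∷ B) (x ∷ w)))))
      x∉X : count x X ≡ 0
      x∉X = proj₁ (count≡0-split x X j B (proj₂ (count≡0-split x A j (X ++ j ∷ B)
              (subst (λ l → count x l ≡ 0) done≡ (count-done once)))))

    neighbourFirst : ∀ j → Neighbours x j → count x w ≡ 1 → OccursBefore j x w
    neighbourFirst j nb once with firstOccurrence x w
    ... | inj₁ x∉w = ⊥-elim (ℕₚ.1+n≢0 (trans (sym once) x∉w))
    ... | inj₂ (X , Y , w≡ , x∉X) with count j X in j∈X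
    ...   | zero  = ⊥-elim (noGap nb done X Y (trans split (cong (λ l → done ++ x ∷ l) w≡)) j∈X)
    ...   | suc _ = subst (OccursBefore j x) (sym w≡) (occursBefore-++ j x X Y x∉X (subst (0 <_) (sym j∈X) (s≤s z≤n)))

    closing : T x ≡ true → count x w ≡ 0 → ∀ k → Scanned T (x ∷ w) k
    closing Tx x∉w k = begin
      pathSum n u k (x ∷ w)                                 ≈⟨ pathSum-descent n u k x w descent ⟩
      pathSum n (rmul u x) k w                              ≡⟨ cong (λ v → pathSum n v k w) closed ⟩
      pathSum n (applyUpTo (matching (pending T w)) n) k w  ≈⟨ ih T keep k ⟩
      statusPoly false (statuses T w) k                     ≡⟨ cong (λ l → statusPoly false l k) sameStatuses ⟩
      statusPoly false (statuses T (x ∷ w)) k               ∎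
      where
      open ≈P-Reasoning
      ox : o x ≡ true
      ox = pending-once T (x ∷ w) x Tx (trans (count-≡ x w) (cong suc x∉w))
      isolated : Isolated o x
      isolated = pending-unchosen T (x ∷ w) (suc x) (chosen-apart x Tx) ,
                 λ j 1+j≡x → pending-unchosen T (x ∷ w) j (chosen-below Tx j 1+j≡x)
      descent : ascends u x ≡ false
      descent = descends-applyUpTo g n x 1+x<n
        (subst₂ _<_ (sym (matching-aboveOpen o x ox (proj₁ isolated))) (sym (matching-open o x ox)) (ℕₚ.n<1+n x))
      closed : rmul u x ≡ applyUpTo (matching (pending T w)) n
      closed = trans (rmul-applyUpTo g n x 1+x<n) (applyUpTo-cong n (λ p _ →
        matching-untoggle (λ q q≢x → pending-∷ T w q≢x) isolated ox (pending-absent T w x∉w) p))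
      sameStatuses : statuses T w ≡ statuses T (x ∷ w)
      sameStatuses = trans (statuses-rest (cong (λ b → statusAt b (count x w)) Tx))
                           (sym (statuses-here (cong (λ b → statusAt b (count x (x ∷ w))) Tx)))

    lastOccurrence : T x ≡ false → count x w ≡ 0 → ∀ k → Scanned T (x ∷ w) k
    lastOccurrence Tx x∉w k = begin
      pathSum n u k (x ∷ w)                                    ≡⟨ pathSum-ascent n u k x w (ascent Tx) ⟩
      addP (pathSum n (rmul u x) k w) (pathSum n u (suc k) w)  ≈⟨ addP-cong (take-dead dead k) (stay Tx k) ⟩
      statusPoly false (statuses T w) (suc k)                  ≡⟨ cong (λ l → statusPoly false l (suc k)) (statuses-rest rest≡) ⟩
      statusPoly false (pre ++ weight 0 ∷ post) (suc k)        ≡⟨ statusPoly-weight-suc pre post 0 false k ⟨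
      statusPoly false (pre ++ weight 1 ∷ post) k              ≡⟨ cong (λ l → statusPoly false l k) (statuses-here here≡) ⟨
      statusPoly false (statuses T (x ∷ w)) k                  ∎
      where
      open ≈P-Reasoning
      rest≡ : statusAt (T x) (count x w) ≡ weight 0
      rest≡ = cong₂ statusAt Tx x∉w
      here≡ : h x ≡ weight 1
      here≡ = cong₂ statusAt Tx (trans (count-≡ x w) (cong suc x∉w))
      dead : Dead n (g ∘ swap x) w
      dead = dead-crossing w (ℕₚ.<-trans (ℕₚ.n<1+n x) 1+x<n) x∉w
        (carries x ℕₚ.≤-refl (subst (x <_) (cong g (sym (swap-left x))) (matching-aboveClosed-≥ o x (pending-unchosen T (x ∷ w) x Tx))))

    chosenAdjacent-vanishes : ∀ a → suc a < n ∸ 1 → choose x T a ≡ true → choose x T (suc a) ≡ true →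
                              ∀ k → statusPoly false (pre ++ chosen ∷ post) k ≈P []
    chosenAdjacent-vanishes a 1+a<m Ca C1+a k = subst (λ l → statusPoly false l k ≈P []) statuses-chosen
      (statusPoly-adjacentChosen (λ i → statusAt (choose x T i) (count i (x ∷ w))) (n ∸ 1) a 1+a<m
        (cong (λ b → statusAt b (count a (x ∷ w))) Ca) (cong (λ b → statusAt b (count (suc a) (x ∷ w))) C1+a) false k)

    both-vanish : ∀ {p q} → p ≈P [] → q ≈P [] → p ≈P q
    both-vanish p≈[] q≈[] = ≈P-trans p≈[] (≈P-sym q≈[])

    blockedAbove : T x ≡ false → count x w ≡ 1 → T (suc x) ≡ true →
                   ∀ k → pathSum n (rmul u x) k w ≈P statusPoly false (pre ++ chosen ∷ post) k
    blockedAbove Tx once T1+x k with count (suc x) w in c1+x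
    ... | zero        = ⊥-elim (closedNeighbour (suc x) (inj₂ refl) T1+x (trans (count-≢ w ℕₚ.1+n≢n) c1+x) once)
    ... | suc (suc _) with s≤s () ← subst (_≤ 1) c1+x (Invariant.chosen-pending keep (suc x) T1+x)
    ... | suc zero    = both-vanish (take-dead dead k)
      (chosenAdjacent-vanishes x (<-∸1 2+x<n) (choose-≡ x T) (trans (choose-≢ T ℕₚ.1+n≢n) T1+x) k)
      where
      o1+x : o (suc x) ≡ true
      o1+x = pending-once T (x ∷ w) (suc x) T1+x (trans (count-≢ w ℕₚ.1+n≢n) c1+x)
      2+x<n : suc (suc x) < n
      2+x<n = valid-letter (suc x) W valid (subst (0 <_) (sym (chosen-twice (suc x) T1+x)) (s≤s z≤n))
      2+x-fixed : swap x (suc (suc x)) ≡ suc (suc x)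
      2+x-fixed = swap-fixed x (suc (suc x)) (ℕₚ.>⇒≢ (ℕₚ.<-trans (ℕₚ.n<1+n x) (ℕₚ.n<1+n (suc x)))) ℕₚ.1+n≢n
      dead : Dead n (g ∘ swap x) w
      dead = dead-upperFirst w (All.tail valid-rest) (neighbourFirst (suc x) (inj₁ refl) once) once c1+x
        (carries (suc (suc x)) (2+x<n , ℕₚ.≤-refl)
          (trans (cong g 2+x-fixed) (matching-aboveOpen o (suc x) o1+x (pending-unchosen T (x ∷ w) (suc (suc x)) (chosen-apart (suc x) T1+x)))))
        (carries x ℕₚ.≤-refl (subst (suc x <_) (sym (trans (cong g (swap-left x)) (matching-open o (suc x) o1+x))) (ℕₚ.n<1+n (suc x))))

    below-≢ : ∀ {a} → suc a ≡ x → a ≢ x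
    below-≢ 1+a≡x a≡x = ℕₚ.1+n≢n (trans 1+a≡x (sym a≡x))

    blockedBelow : T x ≡ false → count x w ≡ 1 → ∀ a → suc a ≡ x → T a ≡ true →
                   ∀ k → pathSum n (rmul u x) k w ≈P statusPoly false (pre ++ chosen ∷ post) k
    blockedBelow Tx once a 1+a≡x Ta k with count a w in ca
    ... | zero        = ⊥-elim (closedNeighbour a (inj₁ (sym 1+a≡x)) Ta (trans (count-≢ w (below-≢ 1+a≡x)) ca) once)
    ... | suc (suc _) with s≤s () ← subst (_≤ 1) ca (Invariant.chosen-pending keep a Ta)
    ... | suc zero    = both-vanish (take-dead (subst (λ y → Dead n (g ∘ swap y) w) 1+a≡x dead) k)
      (chosenAdjacent-vanishes a (subst (_< n ∸ 1) (sym 1+a≡x) x<m) (trans (choose-≢ T a≢x) Ta)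
        (subst (λ y → choose x T y ≡ true) (sym 1+a≡x) (choose-≡ x T)) k)
      where
      a≢x : a ≢ x
      a≢x = below-≢ 1+a≡x
      oa : o a ≡ true
      oa = pending-once T (x ∷ w) a Ta (trans (count-≢ w a≢x) ca)
      o1+a : o (suc a) ≡ false
      o1+a = subst (λ y → o y ≡ false) (sym 1+a≡x) (pending-unchosen T (x ∷ w) x Tx)
      a-fixed : swap (suc a) a ≡ a
      a-fixed = swap-fixed (suc a) a (≢-sym ℕₚ.1+n≢n) (ℕₚ.<⇒≢ (ℕₚ.<-trans (ℕₚ.n<1+n a) (ℕₚ.n<1+n (suc a))))
      dead : Dead n (g ∘ swap (suc a)) w
      dead = dead-lowerFirst w (All.tail valid-rest)
        (subst (λ y → OccursBefore a y w) (sym 1+a≡x) (neighbourFirst a (inj₂ (sym 1+a≡x)) once))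
        ca (subst (λ y → count y w ≡ 1) (sym 1+a≡x) once)
        (carries a ℕₚ.≤-refl (trans (cong g a-fixed) (matching-open o a oa)))
        (carries (suc a) ℕₚ.≤-refl (subst (suc a <_) (cong g (sym (swap-left (suc a)))) (matching-aboveClosed-≥ o (suc a) o1+a)))

    invariant-choose : T x ≡ false → count x w ≡ 1 → T (suc x) ≡ false → (∀ j → suc j ≡ x → T j ≡ false) →
                       Invariant (choose x T) (done ++ x ∷ []) w
    invariant-choose Tx once T1+x noneBelow = record
      { split          = Invariant.split keep
      ; valid-rest     = Invariant.valid-rest keep
      ; chosen-twice   = λ i → twice (i ℕ.≟ x)
      ; chosen-pending = λ i → pendingOnce (i ℕ.≟ x)
      ; chosen-apart   = λ i → apart (i ℕ.≟ x)
      }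
      where
      twice : ∀ {i} → Dec (i ≡ x) → choose x T i ≡ true → count i W ≡ 2
      twice (yes refl) _  = trans count-W (cong₂ (λ a b → a + suc b) (count-done once) once)
      twice (no i≢x)   Ci = chosen-twice _ (trans (sym (choose-≢ T i≢x)) Ci)
      pendingOnce : ∀ {i} → Dec (i ≡ x) → choose x T i ≡ true → count i w ≤ 1
      pendingOnce (yes refl) _  = ℕₚ.≤-reflexive once
      pendingOnce (no i≢x)   Ci = Invariant.chosen-pending keep _ (trans (sym (choose-≢ T i≢x)) Ci)
      apart : ∀ {i} → Dec (i ≡ x) → choose x T i ≡ true → choose x T (suc i) ≡ false
      apart (yes refl) _ = trans (choose-≢ T ℕₚ.1+n≢n) T1+x
      apart {i} (no i≢x) Ci = aboveUnchosen (suc i ℕ.≟ x)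
        where
        Ti : T i ≡ true
        Ti = trans (sym (choose-≢ T i≢x)) Ci
        aboveUnchosen : Dec (suc i ≡ x) → choose x T (suc i) ≡ false
        aboveUnchosen (yes 1+i≡x) with () ← trans (sym Ti) (noneBelow i 1+i≡x)
        aboveUnchosen (no 1+i≢x)  = trans (choose-≢ T 1+i≢x) (chosen-apart i Ti)

    takeFree : T x ≡ false → count x w ≡ 1 → T (suc x) ≡ false → (∀ j → suc j ≡ x → T j ≡ false) →
               ∀ k → pathSum n (rmul u x) k w ≈P statusPoly false (pre ++ chosen ∷ post) k
    takeFree Tx once T1+x noneBelow k = begin
      pathSum n (rmul u x) k w                                     ≡⟨ cong (λ v → pathSum n v k w) toggled ⟩
      pathSum n (applyUpTo (matching (pending (choose x T) w)) n) k w ≈⟨ ih (choose x T) (invariant-choose Tx once T1+x noneBelow) k ⟩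
      statusPoly false (statuses (choose x T) w) k                 ≡⟨ cong (λ l → statusPoly false l k) chosenStatuses ⟩
      statusPoly false (pre ++ chosen ∷ post) k                    ∎
      where
      open ≈P-Reasoning
      agree : AgreeOutside x o (pending (choose x T) w)
      agree p p≢x = trans (pending-∷ T w p≢x) (cong (λ b → b ∧ ⌊ count p w ℕ.≟ 1 ⌋) (sym (choose-≢ T p≢x)))
      isolated : Isolated o x
      isolated = pending-unchosen T (x ∷ w) (suc x) T1+x , λ j 1+j≡x → pending-unchosen T (x ∷ w) j (noneBelow j 1+j≡x)
      toggled : rmul u x ≡ applyUpTo (matching (pending (choose x T) w)) n
      toggled = trans (rmul-applyUpTo g n x 1+x<n) (applyUpTo-cong n (λ p _ →
        matching-toggle agree isolated (pending-unchosen T (x ∷ w) x Tx) (pending-once (choose x T) w x (choose-≡ x T) once) p))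
      chosenStatuses : statuses (choose x T) w ≡ pre ++ chosen ∷ post
      chosenStatuses = trans (statuses-at (choose x T) w (λ q q≢x → choose-≢ T q≢x) (λ q q≢x → sym (count-≢ w q≢x)))
                             (cong (λ b → pre ++ statusAt b (count x w) ∷ post) (choose-≡ x T))

    takeFirst : T x ≡ false → count x w ≡ 1 → ∀ k → pathSum n (rmul u x) k w ≈P statusPoly false (pre ++ chosen ∷ post) k
    takeFirst Tx once k with T (suc x) in T1+x | chosenBelow? T x
    ... | true  | _                     = blockedAbove Tx once T1+x k
    ... | false | inj₂ (a , 1+a≡x , Ta) = blockedBelow Tx once a 1+a≡x Ta k
    ... | false | inj₁ noneBelow        = takeFree Tx once T1+x noneBelow k

    firstOfTwo : T x ≡ false → count x w ≡ 1 → ∀ k → Scanned T (x ∷ w) k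
    firstOfTwo Tx once k = begin
      pathSum n u k (x ∷ w)
        ≡⟨ pathSum-ascent n u k x w (ascent Tx) ⟩
      addP (pathSum n (rmul u x) k w) (pathSum n u (suc k) w)
        ≈⟨ addP-cong (takeFirst Tx once k) (stay Tx k) ⟩
      addP (statusPoly false (pre ++ chosen ∷ post) k) (statusPoly false (statuses T w) (suc k))
        ≡⟨ cong (λ l → addP (statusPoly false (pre ++ chosen ∷ post) k) (statusPoly false l (suc k))) (statuses-rest rest≡) ⟩
      addP (statusPoly false (pre ++ chosen ∷ post) k) (statusPoly false (pre ++ weight 1 ∷ post) (suc k))
        ≈⟨ statusPoly-free pre post false k ⟨
      statusPoly false (pre ++ free ∷ post) k
        ≡⟨ cong (λ l → statusPoly false l k) (statuses-here here≡) ⟨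
      statusPoly false (statuses T (x ∷ w)) k ∎
      where
      open ≈P-Reasoning
      rest≡ : statusAt (T x) (count x w) ≡ weight 1
      rest≡ = cong₂ statusAt Tx once
      here≡ : h x ≡ free
      here≡ = cong₂ statusAt Tx (trans (count-≡ x w) (cong suc once))

    scanned-∷ : ∀ k → Scanned T (x ∷ w) k
    scanned-∷ k with T x in Tx | count x w in cx
    ... | true  | zero        = closing Tx cx k
    ... | false | zero        = lastOccurrence Tx cx k
    ... | false | suc zero    = firstOfTwo Tx cx k
    ... | true  | suc _       with s≤s () ← subst (_≤ 1) (trans (count-≡ x w) (cong suc cx)) (chosen-pending x Tx)
    ... | false | suc (suc _) with s≤s () ← subst (_≤ 1) cx atMostOnceAhead

  scanned : ∀ w done T → Invariant T done w → ∀ k → Scanned T w k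
  scanned []      done T inv = scanned-[] T done inv
  scanned (x ∷ w) done T inv = Step.scanned-∷ x w done T inv (λ T' → scanned w (done ++ x ∷ []) T')

theorem4p5 : ∀ (n : ℕ) (w : List ℕ) →
    ReducedExpr n (prodW n w) w →
    Avoids321 n (prodW n w) →
    (∀ (i : ℕ) → count i w ≤ 2) →
    Rev n w ≈L evalAt (rhsPoly n w) tMinusTinv
theorem4p5 n w reduced avoids atMostTwice = ≈L-trans (Rev≈pathSum n w) (evalT-cong (begin
  pathSum n (idP n) 0 w                                      ≡⟨ cong (λ u → pathSum n u 0 w) nothingChosen ⟩
  pathSum n (applyUpTo (matching (pending none w)) n) 0 w    ≈⟨ scanned w [] none initial 0 ⟩
  statusPoly false (statuses none w) 0                       ≡⟨ cong (λ l → statusPoly false l 0) fromCounts ⟩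
  statusPoly false (map statusOf (countSeq n w)) 0           ≈⟨ statusPoly-counts (countSeq n w) 0 ⟩
  shiftBy (nOne n w) (chainProduct (chains n w))             ≈⟨ mulP-monoP (nOne n w) (chainProduct (chains n w)) ⟨
  rhsPoly n w                                                ∎))
  where
  open ≈P-Reasoning
  open Scanning n w (proj₁ reduced) atMostTwice (noGap reduced avoids)
  none : ℕ → Bool
  none _ = false
  initial : Invariant none [] w
  initial = record
    { split = refl ; valid-rest = proj₁ reduced ; chosen-twice = λ _ () ; chosen-pending = λ _ () ; chosen-apart = λ _ () }
  nothingChosen : idP n ≡ applyUpTo (matching (pending none w)) n
  nothingChosen = applyUpTo-cong n (λ p _ → sym (matching-none (pending none w) (λ _ → refl) p))
  fromCounts : statuses none w ≡ map statusOf (countSeq n w)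
  fromCounts = sym (trans (cong (map statusOf) (List.map-upTo (λ i → count i w) (n ∸ 1)))
                          (List.map-applyUpTo (λ i → count i w) statusOf (n ∸ 1)))
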